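{- If $\varphi\in\mathrm{SPIHML}$, then there is a regular monitor $m$ that is sound for $[\![\varphi]\!]$ and violation-persistently informative (for every $s\in\mathrm{Act}^*$ there is $f\in\mathrm{Act}^\infty$ with $\mathrm{rej}(m,sf)$). If $\varphi\in\mathrm{CPIHML}$, then there is a regular monitor $m$ that is sound for $[\![\varphi]\!]$ and satisfaction-persistently informative (for every $s\in\mathrm{Act}^*$ there is $f$ with $\mathrm{acc}(m,sf)$).
   Context: $\mathrm{Act}$ is a finite set of actions, $\mathrm{Act}^\infty=\mathrm{Act}^*\cup\mathrm{Act}^\omega$. Logic $\mu\mathrm{HML}$: $\varphi::=\mathsf{tt}\mid\mathsf{ff}\mid\varphi\lor\varphi\mid\varphi\land\varphi\mid\langle a\rangle\varphi\mid[a]\varphi\mid\min X.\varphi\mid\max X.\varphi\mid X$, interpreted over $\mathrm{Act}^\infty$: $[\![\mathsf{tt}]\!]=\mathrm{Act}^\infty$, $[\![\mathsf{ff}]\!]=\emptyset$, $\lor,\land$ union/intersection, $[\![[a]\varphi]\!]=\{f\mid f=af'\Rightarrow f'\in[\![\varphi]\!]\}$, $[\![\langle a\rangle\varphi]\!]=\{af\mid f\in[\![\varphi]\!]\}$, $\min X$/$\max X$ least/greatest fixpoints (using valuations). Formulae are closed and guarded. $\mathrm{sHML}$: $\varphi::=\mathsf{tt}\mid\mathsf{ff}\mid[a]\varphi\mid\varphi\land\varphi\mid\max X.\varphi\mid X$; $\mathrm{cHML}$: $\varphi::=\mathsf{tt}\mid\mathsf{ff}\mid\langle a\rangle\varphi\mid\varphi\lor\varphi\mid\min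 X.\varphi\mid X$; $\mathrm{eHML}$: $\varphi::=\mathsf{tt}\mid\mathsf{ff}\mid\min X.\varphi\mid\max X.\varphi\mid X\mid\varphi\lor\varphi\mid\varphi\land\varphi\mid\bigvee_{a\in\mathrm{Act}}\langle a\rangle\varphi_a\mid\bigwedge_{a\in\mathrm{Act}}[a]\varphi_a$. For a closed $\mathrm{sHML}$ (resp. $\mathrm{cHML}$) formula, a subformula $\psi$ can refute (resp. verify) in $0$ unfoldings if $\mathsf{ff}$ (resp. $\mathsf{tt}$) occurs in $\psi$; in $k+1$ unfoldings if it can in $k$, or $X$ occurs in $\psi$ and $\psi$ lies in the scope of a subformula $\max X.\psi'$ (resp. $\min X.\psi'$) that can in $k$ unfoldings; it can refute (verify) if it can in some $k\ge0$ unfoldings. $\mathrm{SPIHML}=\{\varphi_1\land\varphi_2\in\mu\mathrm{HML}\mid\varphi_1\in\mathrm{sHML}\cap\mathrm{eHML},\text{ every subformula of }\varphi_1\text{ can refute}\}$; $\mathrm{CPIHML}=\{\varphi_1\lor\varphi_2\in\mu\mathrm{HML}\mid\varphi_1\in\mathrm{cHML}\cap\mathrm{eHML},\text{ every subformula of }\varphi_1\text{ can verify}\}$. Regular monitors: closed terms $m::=v\mid a.m\mid m+m\mid\mathrm{rec}\,x.m\mid x$ with $v\in\{\mathsf{end},\mathsf{no},\mathsf{yes}\}$ and transitions $a.m\xrightarrow{a}m$, $v\xrightarrow{a}v$, $\mathrm{rec}\,x.m\xrightarrow{a}n$ if $m[\mathrm{rec}\,x.m/x]\xrightarrow{a}n$,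 $m+n\xrightarrow{a}m'$ if $m\xrightarrow{a}m'$ (and symmetrically). For finite $s$, $\mathrm{acc}(m,s)$ ($\mathrm{rej}(m,s)$) iff $m$ reaches $\mathsf{yes}$ ($\mathsf{no}$) via a sequence of transitions labelled $s$; for infinite $t$, iff this holds for some finite prefix of $t$. $m$ is sound for $P$ if $\mathrm{acc}(m,f)\Rightarrow f\in P$ and $\mathrm{rej}(m,f)\Rightarrow f\notin P$. -}

module Defs where

open import Level using (Lift; lift) renaming (suc to lsuc; zero to lzero)
open import Data.Nat using (ℕ; zero; suc)
open import Data.Fin using (Fin; zero; suc)
open import Data.List using (List; []; _∷_; _++_; allFin)
open import Data.Maybe using (Maybe; just; nothing)
open import Data.Product using (Σ; _×_; _,_)
open import Data.Sum using (_⊎_)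
open import Data.Unit.Polymorphic using (⊤)
open import Data.Empty.Polymorphic using (⊥)
import Data.Unit as U
open import Relation.Binary.PropositionalEquality using (_≡_)
open import Relation.Nullary using (¬_)

-- Actions: Act = Fin k (an arbitrary finite set of size k).

data Trace (k : ℕ) : Set where
  fin : List (Fin k) → Trace k
  inf : (ℕ → Fin k) → Trace k

uncons : ∀ {k} → Trace k → Maybe (Fin k × Trace k)
uncons (fin [])      = nothing
uncons (fin (a ∷ l)) = just (a , fin l)
uncons (inf g)       = just (g zero , inf (λ i → g (suc i)))

prepend : ∀ {k} → List (Fin k) → (ℕ → Fin k) → ℕ → Fin k
prepend []      g i       = g i
prepend (a ∷ s) g zero    = a
prepend (a ∷ s) g (suc i) = prepend s g i

_++ᵗ_ : ∀ {k} → List (Fin k) → Trace k → Trace k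
s ++ᵗ fin l = fin (s ++ l)
s ++ᵗ inf g = inf (prepend s g)

takeω : ∀ {k} → ℕ → (ℕ → Fin k) → List (Fin k)
takeω zero    g = []
takeω (suc n) g = g zero ∷ takeω n (λ i → g (suc i))

-- μHML syntax, de Bruijn: Form k n has n free fixpoint variables.

data Form (k n : ℕ) : Set where
  tt ff   : Form k n
  _∨_ _∧_ : Form k n → Form k n → Form k n
  ⟨_⟩_ [_]_ : Fin k → Form k n → Form k n
  mu nu   : Form k (suc n) → Form k n
  var     : Fin n → Form k n

infixr 6 _∧_
infixr 5 _∨_

Env : ℕ → ℕ → Set₁
Env k n = Fin n → Trace k → Set

extend : ∀ {k n} → (Trace k → Set) → Env k n → Env k (suc n)
extend P ρ zero    = P
extend P ρ (suc i) = ρ i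

⟦_⟧ : ∀ {k n} → Form k n → Env k n → Trace k → Set₁
⟦ tt ⟧ ρ t = ⊤
⟦ ff ⟧ ρ t = ⊥
⟦ φ ∨ ψ ⟧ ρ t = ⟦ φ ⟧ ρ t ⊎ ⟦ ψ ⟧ ρ t
⟦ φ ∧ ψ ⟧ ρ t = ⟦ φ ⟧ ρ t × ⟦ ψ ⟧ ρ t
⟦ ⟨ a ⟩ φ ⟧ ρ t = Σ (Trace _) λ t' → (uncons t ≡ just (a , t')) × ⟦ φ ⟧ ρ t'
⟦ [ a ] φ ⟧ ρ t = ∀ t' → uncons t ≡ just (a , t') → ⟦ φ ⟧ ρ t'
⟦ mu φ ⟧ ρ t = ∀ (P : Trace _ → Set) → (∀ u → ⟦ φ ⟧ (extend P ρ) u → P u) → P t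
⟦ nu φ ⟧ ρ t = Σ (Trace _ → Set) λ P → (∀ u → P u → ⟦ φ ⟧ (extend P ρ) u) × P t
⟦ var i ⟧ ρ t = Lift (lsuc lzero) (ρ i t)

⟦_⟧₀ : ∀ {k} → Form k 0 → Trace k → Set₁
⟦ φ ⟧₀ = ⟦ φ ⟧ (λ ())

-- Guardedness: every occurrence of a bound variable lies under a
-- modality within the body of its binder.

GuardedVar : ∀ {k n} → Fin n → Form k n → Set
GuardedVar i tt = U.⊤
GuardedVar i ff = U.⊤
GuardedVar i (φ ∨ ψ) = GuardedVar i φ × GuardedVar i ψ
GuardedVar i (φ ∧ ψ) = GuardedVar i φ × GuardedVar i ψ
GuardedVar i (⟨ a ⟩ φ) = U.⊤
GuardedVar i ([ a ] φ) = U.⊤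
GuardedVar i (mu φ) = GuardedVar (suc i) φ
GuardedVar i (nu φ) = GuardedVar (suc i) φ
GuardedVar i (var j) = ¬ (j ≡ i)

Guarded : ∀ {k n} → Form k n → Set
Guarded tt = U.⊤
Guarded ff = U.⊤
Guarded (φ ∨ ψ) = Guarded φ × Guarded ψ
Guarded (φ ∧ ψ) = Guarded φ × Guarded ψ
Guarded (⟨ a ⟩ φ) = Guarded φ
Guarded ([ a ] φ) = Guarded φ
Guarded (mu φ) = GuardedVar zero φ × Guarded φ
Guarded (nu φ) = GuardedVar zero φ × Guarded φ
Guarded (var j) = U.⊤

-- ⋀_{a∈Act}[a]φ_a and ⋁_{a∈Act}⟨a⟩φ_a as right-nested binary
-- conjunctions/disjunctions over the actions in order
-- (empty conjunction = tt, empty disjunction = ff).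
bigAnd : ∀ {k n} → List (Fin k) → (Fin k → Form k n) → Form k n
bigAnd [] φs = tt
bigAnd (a ∷ []) φs = [ a ] φs a
bigAnd (a ∷ b ∷ l) φs = [ a ] φs a ∧ bigAnd (b ∷ l) φs

bigOr : ∀ {k n} → List (Fin k) → (Fin k → Form k n) → Form k n
bigOr [] φs = ff
bigOr (a ∷ []) φs = ⟨ a ⟩ φs a
bigOr (a ∷ b ∷ l) φs = ⟨ a ⟩ φs a ∨ bigOr (b ∷ l) φs

⋀[] : ∀ {k n} → (Fin k → Form k n) → Form k n
⋀[] {k} φs = bigAnd (allFin k) φs

⋁⟨⟩ : ∀ {k n} → (Fin k → Form k n) → Form k n
⋁⟨⟩ {k} φs = bigOr (allFin k) φs

data IsS {k : ℕ} : ∀ {n} → Form k n → Set where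
  tt  : ∀ {n} → IsS {n = n} tt
  ff  : ∀ {n} → IsS {n = n} ff
  box : ∀ {n} a {φ : Form k n} → IsS φ → IsS ([ a ] φ)
  and : ∀ {n} {φ ψ : Form k n} → IsS φ → IsS ψ → IsS (φ ∧ ψ)
  nu  : ∀ {n} {φ : Form k (suc n)} → IsS φ → IsS (nu φ)
  var : ∀ {n} (i : Fin n) → IsS (var {k} i)

data IsC {k : ℕ} : ∀ {n} → Form k n → Set where
  tt  : ∀ {n} → IsC {n = n} tt
  ff  : ∀ {n} → IsC {n = n} ff
  dia : ∀ {n} a {φ : Form k n} → IsC φ → IsC (⟨ a ⟩ φ)
  or  : ∀ {n} {φ ψ : Form k n} → IsC φ → IsC ψ → IsC (φ ∨ ψ)
  mu  : ∀ {n} {φ : Form k (suc n)} → IsC φ → IsC (mu φ)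
  var : ∀ {n} (i : Fin n) → IsC (var {k} i)

data IsE {k : ℕ} : ∀ {n} → Form k n → Set where
  tt  : ∀ {n} → IsE {n = n} tt
  ff  : ∀ {n} → IsE {n = n} ff
  mu  : ∀ {n} {φ : Form k (suc n)} → IsE φ → IsE (mu φ)
  nu  : ∀ {n} {φ : Form k (suc n)} → IsE φ → IsE (nu φ)
  var : ∀ {n} (i : Fin n) → IsE (var {k} i)
  or  : ∀ {n} {φ ψ : Form k n} → IsE φ → IsE ψ → IsE (φ ∨ ψ)
  and : ∀ {n} {φ ψ : Form k n} → IsE φ → IsE ψ → IsE (φ ∧ ψ)
  bigOrE  : ∀ {n} (φs : Fin k → Form k n) → (∀ a → IsE (φs a)) → IsE (⋁⟨⟩ φs)
  bigAndE : ∀ {n} (φs : Fin k → Form k n) → (∀ a → IsE (φs a)) → IsE (⋀[] φs)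

-- Subformula occurrences: one-hole contexts from the root (n free
-- variables) to the hole (m free variables), built outside-in.

data Ctx (k n : ℕ) : ℕ → Set where
  hole : Ctx k n n
  ∧ˡ   : ∀ {m} → Ctx k n m → Form k n → Ctx k n m
  ∧ʳ   : ∀ {m} → Form k n → Ctx k n m → Ctx k n m
  ∨ˡ   : ∀ {m} → Ctx k n m → Form k n → Ctx k n m
  ∨ʳ   : ∀ {m} → Form k n → Ctx k n m → Ctx k n m
  ⟨⟩   : ∀ {m} → Fin k → Ctx k n m → Ctx k n m
  []   : ∀ {m} → Fin k → Ctx k n m → Ctx k n m
  muC  : ∀ {m} → Ctx k (suc n) m → Ctx k n m
  nuC  : ∀ {m} → Ctx k (suc n) m → Ctx k n m

plug : ∀ {k n m} → Ctx k n m → Form k m → Form k n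
plug hole ψ = ψ
plug (∧ˡ C χ) ψ = plug C ψ ∧ χ
plug (∧ʳ χ C) ψ = χ ∧ plug C ψ
plug (∨ˡ C χ) ψ = plug C ψ ∨ χ
plug (∨ʳ χ C) ψ = χ ∨ plug C ψ
plug (⟨⟩ a C) ψ = ⟨ a ⟩ plug C ψ
plug ([] a C) ψ = [ a ] plug C ψ
plug (muC C) ψ = mu (plug C ψ)
plug (nuC C) ψ = nu (plug C ψ)

_⨾_ : ∀ {k n m l} → Ctx k n m → Ctx k m l → Ctx k n l
hole ⨾ D = D
∧ˡ C χ ⨾ D = ∧ˡ (C ⨾ D) χ
∧ʳ χ C ⨾ D = ∧ʳ χ (C ⨾ D)
∨ˡ C χ ⨾ D = ∨ˡ (C ⨾ D) χ
∨ʳ χ C ⨾ D = ∨ʳ χ (C ⨾ D)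
⟨⟩ a C ⨾ D = ⟨⟩ a (C ⨾ D)
[] a C ⨾ D = [] a (C ⨾ D)
muC C ⨾ D = muC (C ⨾ D)
nuC C ⨾ D = nuC (C ⨾ D)

-- a variable in scope at the top of a context, as seen at the hole
liftVar : ∀ {k n m} → Ctx k n m → Fin n → Fin m
liftVar hole i = i
liftVar (∧ˡ C _) i = liftVar C i
liftVar (∧ʳ _ C) i = liftVar C i
liftVar (∨ˡ C _) i = liftVar C i
liftVar (∨ʳ _ C) i = liftVar C i
liftVar (⟨⟩ _ C) i = liftVar C i
liftVar ([] _ C) i = liftVar C i
liftVar (muC C) i = liftVar C (suc i)
liftVar (nuC C) i = liftVar C (suc i)

data FreeIn {k : ℕ} : ∀ {n} → Fin n → Form k n → Set where
  here : ∀ {n} {i : Fin n} → FreeIn i (var i)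
  ∧l : ∀ {n i} {φ ψ : Form k n} → FreeIn i φ → FreeIn i (φ ∧ ψ)
  ∧r : ∀ {n i} {φ ψ : Form k n} → FreeIn i ψ → FreeIn i (φ ∧ ψ)
  ∨l : ∀ {n i} {φ ψ : Form k n} → FreeIn i φ → FreeIn i (φ ∨ ψ)
  ∨r : ∀ {n i} {φ ψ : Form k n} → FreeIn i ψ → FreeIn i (φ ∨ ψ)
  dia : ∀ {n i a} {φ : Form k n} → FreeIn i φ → FreeIn i (⟨ a ⟩ φ)
  box : ∀ {n i a} {φ : Form k n} → FreeIn i φ → FreeIn i ([ a ] φ)
  mu : ∀ {n i} {φ : Form k (suc n)} → FreeIn (suc i) φ → FreeIn i (mu φ)
  nu : ∀ {n i} {φ : Form k (suc n)} → FreeIn (suc i) φ → FreeIn i (nu φ)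

data Occurs {k : ℕ} (c : ∀ {n} → Form k n) : ∀ {n} → Form k n → Set where
  here : ∀ {n} → Occurs c (c {n})
  ∧l : ∀ {n} {φ ψ : Form k n} → Occurs c φ → Occurs c (φ ∧ ψ)
  ∧r : ∀ {n} {φ ψ : Form k n} → Occurs c ψ → Occurs c (φ ∧ ψ)
  ∨l : ∀ {n} {φ ψ : Form k n} → Occurs c φ → Occurs c (φ ∨ ψ)
  ∨r : ∀ {n} {φ ψ : Form k n} → Occurs c ψ → Occurs c (φ ∨ ψ)
  dia : ∀ {n a} {φ : Form k n} → Occurs c φ → Occurs c (⟨ a ⟩ φ)
  box : ∀ {n a} {φ : Form k n} → Occurs c φ → Occurs c ([ a ] φ)
  mu : ∀ {n} {φ : Form k (suc n)} → Occurs c φ → Occurs c (mu φ)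
  nu : ∀ {n} {φ : Form k (suc n)} → Occurs c φ → Occurs c (nu φ)

-- "can refute / verify in j unfoldings" for the subformula ψ occurring
-- at context C in a closed formula (the formula is plug C ψ).

CanRefuteIn : ∀ {k m} → ℕ → Ctx k 0 m → Form k m → Set
CanRefuteIn {k} zero C ψ = Occurs {k} ff ψ
CanRefuteIn {k} {m} (suc j) C ψ =
  CanRefuteIn j C ψ ⊎
  Σ ℕ λ d → Σ (Ctx k 0 d) λ D → Σ (Ctx k (suc d) m) λ E →
    (C ≡ D ⨾ nuC E) × FreeIn (liftVar E zero) ψ × CanRefuteIn j D (nu (plug E ψ))

CanVerifyIn : ∀ {k m} → ℕ → Ctx k 0 m → Form k m → Set
CanVerifyIn {k} zero C ψ = Occurs {k} tt ψ
CanVerifyIn {k} {m} (suc j) C ψ =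
  CanVerifyIn j C ψ ⊎
  Σ ℕ λ d → Σ (Ctx k 0 d) λ D → Σ (Ctx k (suc d) m) λ E →
    (C ≡ D ⨾ muC E) × FreeIn (liftVar E zero) ψ × CanVerifyIn j D (mu (plug E ψ))

AllCanRefute : ∀ {k} → Form k 0 → Set
AllCanRefute {k} φ = ∀ {m} (C : Ctx k 0 m) (ψ : Form k m) → plug C ψ ≡ φ →
  Σ ℕ λ j → CanRefuteIn j C ψ

AllCanVerify : ∀ {k} → Form k 0 → Set
AllCanVerify {k} φ = ∀ {m} (C : Ctx k 0 m) (ψ : Form k m) → plug C ψ ≡ φ →
  Σ ℕ λ j → CanVerifyIn j C ψ

-- SPIHML / CPIHML (formulae of μHML are closed and guarded)
data SPIHML {k : ℕ} : Form k 0 → Set where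
  spi : (φ₁ φ₂ : Form k 0) → Guarded (φ₁ ∧ φ₂) → IsS φ₁ → IsE φ₁ →
        AllCanRefute φ₁ → SPIHML (φ₁ ∧ φ₂)

data CPIHML {k : ℕ} : Form k 0 → Set where
  cpi : (φ₁ φ₂ : Form k 0) → Guarded (φ₁ ∨ φ₂) → IsC φ₁ → IsE φ₁ →
        AllCanVerify φ₁ → CPIHML (φ₁ ∨ φ₂)

data Verdict : Set where
  end no yes : Verdict

data Mon (k n : ℕ) : Set where
  verd : Verdict → Mon k n
  _·_  : Fin k → Mon k n → Mon k n
  _⊕_  : Mon k n → Mon k n → Mon k n
  rec  : Mon k (suc n) → Mon k n
  mvar : Fin n → Mon k n

extR : ∀ {n m} → (Fin n → Fin m) → Fin (suc n) → Fin (suc m)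
extR r zero = zero
extR r (suc i) = suc (r i)

ren : ∀ {k n m} → (Fin n → Fin m) → Mon k n → Mon k m
ren r (verd v) = verd v
ren r (a · M) = a · ren r M
ren r (M ⊕ N) = ren r M ⊕ ren r N
ren r (rec M) = rec (ren (extR r) M)
ren r (mvar i) = mvar (r i)

extS : ∀ {k n m} → (Fin n → Mon k m) → Fin (suc n) → Mon k (suc m)
extS σ zero = mvar zero
extS σ (suc i) = ren suc (σ i)

sub : ∀ {k n m} → (Fin n → Mon k m) → Mon k n → Mon k m
sub σ (verd v) = verd v
sub σ (a · M) = a · sub σ M
sub σ (M ⊕ N) = sub σ M ⊕ sub σ N
sub σ (rec M) = rec (sub (extS σ) M)
sub σ (mvar i) = σ i

sub₀ : ∀ {k n} → Mon k n → Fin (suc n) → Mon k n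
sub₀ N zero = N
sub₀ N (suc i) = mvar i

_[_]₀ : ∀ {k n} → Mon k (suc n) → Mon k n → Mon k n
M [ N ]₀ = sub (sub₀ N) M

data _—[_]→_ {k : ℕ} : Mon k 0 → Fin k → Mon k 0 → Set where
  act  : ∀ {a M} → (a · M) —[ a ]→ M
  verd : ∀ {v a} → verd v —[ a ]→ verd v
  rec  : ∀ {M a N} → (M [ rec M ]₀) —[ a ]→ N → rec M —[ a ]→ N
  sumL : ∀ {M N a M'} → M —[ a ]→ M' → (M ⊕ N) —[ a ]→ M'
  sumR : ∀ {M N a N'} → N —[ a ]→ N' → (M ⊕ N) —[ a ]→ N'

data _=[_]⇒_ {k : ℕ} : Mon k 0 → List (Fin k) → Mon k 0 → Set where
  done : ∀ {M} → M =[ [] ]⇒ M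
  step : ∀ {M a M' s M''} → M —[ a ]→ M' → M' =[ s ]⇒ M'' → M =[ a ∷ s ]⇒ M''

reaches : ∀ {k} → Verdict → Mon k 0 → Trace k → Set
reaches v M (fin s) = M =[ s ]⇒ verd v
reaches v M (inf g) = Σ ℕ λ n → M =[ takeω n g ]⇒ verd v

acc rej : ∀ {k} → Mon k 0 → Trace k → Set
acc = reaches yes
rej = reaches no

Sound : ∀ {k} → Mon k 0 → (Trace k → Set₁) → Set₁
Sound M P = (∀ f → acc M f → P f) × (∀ f → rej M f → ¬ P f)

ViolationPersistentlyInformative : ∀ {k} → Mon k 0 → Set
ViolationPersistentlyInformative {k} M =
  ∀ (s : List (Fin k)) → Σ (Trace k) λ f → rej M (s ++ᵗ f)

SatisfactionPersistentlyInformative : ∀ {k} → Mon k 0 → Set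
SatisfactionPersistentlyInformative {k} M =
  ∀ (s : List (Fin k)) → Σ (Trace k) λ f → acc M (s ++ᵗ f)

-- The monitors are synthesised compositionally: ff becomes `no`, [a]φ the prefix a.m, ∧ a
-- choice and max X a recursion (dually tt, ⟨a⟩, ∨ and min X for cHML). Soundness: if the
-- monitor of φ is committed to `no` after s, no trace extending s satisfies φ; this goes by
-- induction on the length of s, guardedness ensuring that a fixpoint variable is consulted
-- only after an action has been consumed. Persistence: for φ in eHML every state the monitor
-- reaches is again the monitor of a subformula occurrence of φ (an explicit conjunction
-- ⋀[a]φₐ has a branch for every action), and a subformula that can refute still leads to
-- `no`, either through an ff or through the variable of a ν-binder that can refute. The cHML
-- half is dual: its monitor is the verdict-swapped monitor of the dual formula.

module Submission where

open import Defs
open import Level using (lift)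
open import Data.Nat using (ℕ; zero; suc; _≤_; _<_; s≤s)
open import Data.Nat.Properties using (≤-trans; ≤-refl; <-trans; ≤-pred; ≤-<-trans; m<n⇒m<1+n; n≤1+n)
open import Data.Fin using (Fin; zero; suc)
open import Data.List using (List; []; _∷_; _++_; allFin; length)
open import Data.List.Properties using (++-assoc)
open import Data.List.Relation.Unary.Any using (here; there)
open import Data.List.Membership.Propositional using (_∈_)
open import Data.List.Membership.Propositional.Properties using (∈-allFin)
open import Data.Maybe using (just)
open import Data.Product using (Σ; _×_; _,_; proj₁)
open import Data.Sum using (_⊎_; inj₁; inj₂)
open import Data.Empty using (⊥-elim)
import Data.Unit as U
open import Relation.Binary.PropositionalEquality hiding ([_])
open import Relation.Nullary using (¬_)

-- Substitution on monitors

extR-cong : ∀ {n m} {r r′ : Fin n → Fin m} → r ≗ r′ → extR r ≗ extR r′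
extR-cong e zero    = refl
extR-cong e (suc i) = cong suc (e i)

ren-cong : ∀ {k n m} {r r′ : Fin n → Fin m} → r ≗ r′ → (M : Mon k n) → ren r M ≡ ren r′ M
ren-cong e (verd v) = refl
ren-cong e (a · M)  = cong (a ·_) (ren-cong e M)
ren-cong e (M ⊕ N)  = cong₂ _⊕_ (ren-cong e M) (ren-cong e N)
ren-cong e (rec M)  = cong rec (ren-cong (extR-cong e) M)
ren-cong e (mvar i) = cong mvar (e i)

extS-cong : ∀ {k n m} {σ τ : Fin n → Mon k m} → σ ≗ τ → extS σ ≗ extS τ
extS-cong e zero    = refl
extS-cong e (suc i) = cong (ren suc) (e i)

sub-cong : ∀ {k n m} {σ τ : Fin n → Mon k m} → σ ≗ τ → (M : Mon k n) → sub σ M ≡ sub τ M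
sub-cong e (verd v) = refl
sub-cong e (a · M)  = cong (a ·_) (sub-cong e M)
sub-cong e (M ⊕ N)  = cong₂ _⊕_ (sub-cong e M) (sub-cong e N)
sub-cong e (rec M)  = cong rec (sub-cong (extS-cong e) M)
sub-cong e (mvar i) = e i

ren-ren : ∀ {k n m l} (r : Fin m → Fin l) (r′ : Fin n → Fin m) (M : Mon k n) →
          ren r (ren r′ M) ≡ ren (λ i → r (r′ i)) M
ren-ren r r′ (verd v) = refl
ren-ren r r′ (a · M)  = cong (a ·_) (ren-ren r r′ M)
ren-ren r r′ (M ⊕ N)  = cong₂ _⊕_ (ren-ren r r′ M) (ren-ren r r′ N)
ren-ren r r′ (rec M)  = cong rec (trans (ren-ren (extR r) (extR r′) M) (ren-cong ext-∘ M))
  where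
  ext-∘ : (λ i → extR r (extR r′ i)) ≗ extR (λ j → r (r′ j))
  ext-∘ zero    = refl
  ext-∘ (suc i) = refl
ren-ren r r′ (mvar i) = refl

sub-ren : ∀ {k n m l} (σ : Fin m → Mon k l) (r : Fin n → Fin m) (M : Mon k n) →
          sub σ (ren r M) ≡ sub (λ i → σ (r i)) M
sub-ren σ r (verd v) = refl
sub-ren σ r (a · M)  = cong (a ·_) (sub-ren σ r M)
sub-ren σ r (M ⊕ N)  = cong₂ _⊕_ (sub-ren σ r M) (sub-ren σ r N)
sub-ren σ r (rec M)  = cong rec (trans (sub-ren (extS σ) (extR r) M) (sub-cong ext-∘ M))
  where
  ext-∘ : (λ i → extS σ (extR r i)) ≗ extS (λ j → σ (r j))
  ext-∘ zero    = refl
  ext-∘ (suc i) = refl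
sub-ren σ r (mvar i) = refl

ren-sub : ∀ {k n m l} (r : Fin m → Fin l) (σ : Fin n → Mon k m) (M : Mon k n) →
          ren r (sub σ M) ≡ sub (λ i → ren r (σ i)) M
ren-sub r σ (verd v) = refl
ren-sub r σ (a · M)  = cong (a ·_) (ren-sub r σ M)
ren-sub r σ (M ⊕ N)  = cong₂ _⊕_ (ren-sub r σ M) (ren-sub r σ N)
ren-sub r σ (rec M)  = cong rec (trans (ren-sub (extR r) (extS σ) M) (sub-cong ext-∘ M))
  where
  ext-∘ : (λ i → ren (extR r) (extS σ i)) ≗ extS (λ j → ren r (σ j))
  ext-∘ zero    = refl
  ext-∘ (suc i) = trans (ren-ren (extR r) suc (σ i)) (sym (ren-ren suc r (σ i)))
ren-sub r σ (mvar i) = refl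

sub-sub : ∀ {k n m l} (τ : Fin m → Mon k l) (σ : Fin n → Mon k m) (M : Mon k n) →
          sub τ (sub σ M) ≡ sub (λ i → sub τ (σ i)) M
sub-sub τ σ (verd v) = refl
sub-sub τ σ (a · M)  = cong (a ·_) (sub-sub τ σ M)
sub-sub τ σ (M ⊕ N)  = cong₂ _⊕_ (sub-sub τ σ M) (sub-sub τ σ N)
sub-sub τ σ (rec M)  = cong rec (trans (sub-sub (extS τ) (extS σ) M) (sub-cong ext-∘ M))
  where
  ext-∘ : (λ i → sub (extS τ) (extS σ i)) ≗ extS (λ j → sub τ (σ j))
  ext-∘ zero    = refl
  ext-∘ (suc i) = trans (sub-ren (extS τ) suc (σ i)) (sym (ren-sub suc τ (σ i)))
sub-sub τ σ (mvar i) = refl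

sub-id : ∀ {k n} (M : Mon k n) → sub mvar M ≡ M
sub-id (verd v) = refl
sub-id (a · M)  = cong (a ·_) (sub-id M)
sub-id (M ⊕ N)  = cong₂ _⊕_ (sub-id M) (sub-id N)
sub-id (rec M)  = cong rec (trans (sub-cong ext-id M) (sub-id M))
  where
  ext-id : extS mvar ≗ mvar
  ext-id zero    = refl
  ext-id (suc i) = refl
sub-id (mvar i) = refl

∅ₛ : ∀ {k} → Fin 0 → Mon k 0
∅ₛ ()

_∷ₛ_ : ∀ {k n} → Mon k 0 → (Fin n → Mon k 0) → Fin (suc n) → Mon k 0
(R ∷ₛ σ) zero    = R
(R ∷ₛ σ) (suc i) = σ i

sub-extS-[]₀ : ∀ {k n} (R : Mon k 0) (σ : Fin n → Mon k 0) (M : Mon k (suc n)) →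
               sub (extS σ) M [ R ]₀ ≡ sub (R ∷ₛ σ) M
sub-extS-[]₀ R σ M = trans (sub-sub (sub₀ R) (extS σ) M) (sub-cong instantiate M)
  where
  instantiate : (λ i → sub (sub₀ R) (extS σ i)) ≗ R ∷ₛ σ
  instantiate zero    = refl
  instantiate (suc i) = trans (sub-ren (sub₀ R) suc (σ i)) (sub-id (σ i))

-- Runs of monitors

-- `Shows v M`: M is committed to v, i.e. it moves to `verd v` on whatever action comes next.
data Shows {k} (v : Verdict) : Mon k 0 → Set where
  verd : Shows v (verd v)
  sumL : ∀ {M N} → Shows v M → Shows v (M ⊕ N)
  sumR : ∀ {M N} → Shows v N → Shows v (M ⊕ N)
  rec  : ∀ {M} → Shows v (M [ rec M ]₀) → Shows v (rec M)

ShowsAfter : ∀ {k} → Verdict → Mon k 0 → List (Fin k) → Set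
ShowsAfter v M s = Σ _ λ M′ → (M =[ s ]⇒ M′) × Shows v M′

Shows⇒step : ∀ {k v a} {M : Mon k 0} → Shows v M → M —[ a ]→ verd v
Shows⇒step verd     = verd
Shows⇒step (sumL x) = sumL (Shows⇒step x)
Shows⇒step (sumR x) = sumR (Shows⇒step x)
Shows⇒step (rec x)  = rec (Shows⇒step x)

⇒-snoc : ∀ {k} {M M′ M″ : Mon k 0} {s a} → M =[ s ]⇒ M′ → M′ —[ a ]→ M″ → M =[ s ++ a ∷ [] ]⇒ M″
⇒-snoc done       d = step d done
⇒-snoc (step d p) e = step d (⇒-snoc p e)

⇒-ShowsAfter : ∀ {k v s} {M : Mon k 0} → M =[ s ]⇒ verd v → ShowsAfter v M s
⇒-ShowsAfter p = _ , p , verd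

verd-⇒ : ∀ {k v s} {M : Mon k 0} → verd v =[ s ]⇒ M → M ≡ verd v
verd-⇒ done          = refl
verd-⇒ (step verd p) = verd-⇒ p

verd-⇒-verd : ∀ {k v} (s : List (Fin k)) → verd v =[ s ]⇒ verd v
verd-⇒-verd []      = done
verd-⇒-verd (a ∷ s) = step verd (verd-⇒-verd s)

ShowsAfter-⊕⁻ : ∀ {k v s} {M N : Mon k 0} → ShowsAfter v (M ⊕ N) s → ShowsAfter v M s ⊎ ShowsAfter v N s
ShowsAfter-⊕⁻ (_ , done , sumL x)       = inj₁ (_ , done , x)
ShowsAfter-⊕⁻ (_ , done , sumR x)       = inj₂ (_ , done , x)
ShowsAfter-⊕⁻ (_ , step (sumL d) p , x) = inj₁ (_ , step d p , x)
ShowsAfter-⊕⁻ (_ , step (sumR d) p , x) = inj₂ (_ , step d p , x)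

ShowsAfter-⊕ˡ : ∀ {k v s} {M N : Mon k 0} → ShowsAfter v M s → ShowsAfter v (M ⊕ N) s
ShowsAfter-⊕ˡ (_ , done , x)     = _ , done , sumL x
ShowsAfter-⊕ˡ (_ , step d p , x) = _ , step (sumL d) p , x

ShowsAfter-⊕ʳ : ∀ {k v s} {M N : Mon k 0} → ShowsAfter v N s → ShowsAfter v (M ⊕ N) s
ShowsAfter-⊕ʳ (_ , done , x)     = _ , done , sumR x
ShowsAfter-⊕ʳ (_ , step d p , x) = _ , step (sumR d) p , x

ShowsAfter-· : ∀ {k v s a} {M : Mon k 0} → ShowsAfter v M s → ShowsAfter v (a · M) (a ∷ s)
ShowsAfter-· (_ , p , x) = _ , step act p , x

ShowsAfter-rec⁻ : ∀ {k v s} {M : Mon k 1} → ShowsAfter v (rec M) s → ShowsAfter v (M [ rec M ]₀) s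
ShowsAfter-rec⁻ (_ , done , rec x)      = _ , done , x
ShowsAfter-rec⁻ (_ , step (rec d) p , x) = _ , step d p , x

ShowsAfter-rec⁺ : ∀ {k v s} {M : Mon k 1} → ShowsAfter v (M [ rec M ]₀) s → ShowsAfter v (rec M) s
ShowsAfter-rec⁺ (_ , done , x)     = _ , done , rec x
ShowsAfter-rec⁺ (_ , step d p , x) = _ , step (rec d) p , x

mapV : ∀ {k n} → (Verdict → Verdict) → Mon k n → Mon k n
mapV f (verd v) = verd (f v)
mapV f (a · M)  = a · mapV f M
mapV f (M ⊕ N)  = mapV f M ⊕ mapV f N
mapV f (rec M)  = rec (mapV f M)
mapV f (mvar i) = mvar i

mapV-ren : ∀ {k n m} f (r : Fin n → Fin m) (M : Mon k n) → mapV f (ren r M) ≡ ren r (mapV f M)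
mapV-ren f r (verd v) = refl
mapV-ren f r (a · M)  = cong (a ·_) (mapV-ren f r M)
mapV-ren f r (M ⊕ N)  = cong₂ _⊕_ (mapV-ren f r M) (mapV-ren f r N)
mapV-ren f r (rec M)  = cong rec (mapV-ren f (extR r) M)
mapV-ren f r (mvar i) = refl

mapV-sub : ∀ {k n m} f (σ : Fin n → Mon k m) (M : Mon k n) →
           mapV f (sub σ M) ≡ sub (λ i → mapV f (σ i)) (mapV f M)
mapV-sub f σ (verd v) = refl
mapV-sub f σ (a · M)  = cong (a ·_) (mapV-sub f σ M)
mapV-sub f σ (M ⊕ N)  = cong₂ _⊕_ (mapV-sub f σ M) (mapV-sub f σ N)
mapV-sub f σ (rec M)  = cong rec (trans (mapV-sub f (extS σ) M) (sub-cong ext-mapV (mapV f M)))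
  where
  ext-mapV : (λ i → mapV f (extS σ i)) ≗ extS (λ j → mapV f (σ j))
  ext-mapV zero    = refl
  ext-mapV (suc i) = mapV-ren f suc (σ i)
mapV-sub f σ (mvar i) = refl

mapV-[]₀ : ∀ {k n} f (M : Mon k (suc n)) (N : Mon k n) → mapV f (M [ N ]₀) ≡ mapV f M [ mapV f N ]₀
mapV-[]₀ f M N = trans (mapV-sub f (sub₀ N) M) (sub-cong sub₀-mapV (mapV f M))
  where
  sub₀-mapV : (λ i → mapV f (sub₀ N i)) ≗ sub₀ (mapV f N)
  sub₀-mapV zero    = refl
  sub₀-mapV (suc i) = refl

mapV-step : ∀ {k} f {M M′ : Mon k 0} {a} → M —[ a ]→ M′ → mapV f M —[ a ]→ mapV f M′
mapV-step f act      = act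
mapV-step f verd     = verd
mapV-step f {rec M} {M′} {a} (rec d) =
  rec (subst (λ X → X —[ a ]→ mapV f M′) (mapV-[]₀ f M (rec M)) (mapV-step f d))
mapV-step f (sumL d) = sumL (mapV-step f d)
mapV-step f (sumR d) = sumR (mapV-step f d)

mapV-⇒ : ∀ {k} f {M M′ : Mon k 0} {s} → M =[ s ]⇒ M′ → mapV f M =[ s ]⇒ mapV f M′
mapV-⇒ f done       = done
mapV-⇒ f (step d p) = step (mapV-step f d) (mapV-⇒ f p)

mapV-Shows : ∀ {k} f {v} {M : Mon k 0} → Shows v M → Shows (f v) (mapV f M)
mapV-Shows f verd     = verd
mapV-Shows f (sumL x) = sumL (mapV-Shows f x)
mapV-Shows f (sumR x) = sumR (mapV-Shows f x)
mapV-Shows f {v} {rec M} (rec x) = rec (subst (Shows (f v)) (mapV-[]₀ f M (rec M)) (mapV-Shows f x))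

mapV-ShowsAfter : ∀ {k} f {v} {M : Mon k 0} {s} → ShowsAfter v M s → ShowsAfter (f v) (mapV f M) s
mapV-ShowsAfter f (M′ , p , x) = mapV f M′ , mapV-⇒ f p , mapV-Shows f x

data Avoids {k} (v : Verdict) : ∀ {n} → Mon k n → Set where
  verd : ∀ {n w} → ¬ w ≡ v → Avoids v {n} (verd w)
  act  : ∀ {n a} {M : Mon k n} → Avoids v M → Avoids v (a · M)
  sum  : ∀ {n} {M N : Mon k n} → Avoids v M → Avoids v N → Avoids v (M ⊕ N)
  rec  : ∀ {n} {M : Mon k (suc n)} → Avoids v M → Avoids v (rec M)
  mvar : ∀ {n} {i : Fin n} → Avoids v (mvar i)

Avoids-ren : ∀ {k v n m} (r : Fin n → Fin m) {M : Mon k n} → Avoids v M → Avoids v (ren r M)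
Avoids-ren r (verd x)  = verd x
Avoids-ren r (act x)   = act (Avoids-ren r x)
Avoids-ren r (sum x y) = sum (Avoids-ren r x) (Avoids-ren r y)
Avoids-ren r (rec x)   = rec (Avoids-ren (extR r) x)
Avoids-ren r mvar      = mvar

Avoids-sub : ∀ {k v n m} {σ : Fin n → Mon k m} → (∀ i → Avoids v (σ i)) →
             {M : Mon k n} → Avoids v M → Avoids v (sub σ M)
Avoids-sub h (verd x)  = verd x
Avoids-sub h (act x)   = act (Avoids-sub h x)
Avoids-sub h (sum x y) = sum (Avoids-sub h x) (Avoids-sub h y)
Avoids-sub {σ = σ} h (rec x) = rec (Avoids-sub ext x)
  where
  ext : ∀ i → Avoids _ (extS σ i)
  ext zero    = mvar
  ext (suc i) = Avoids-ren suc (h i)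
Avoids-sub h (mvar {i = i}) = h i

Avoids-step : ∀ {k v a} {M M′ : Mon k 0} → M —[ a ]→ M′ → Avoids v M → Avoids v M′
Avoids-step act      (act x)   = x
Avoids-step verd     x         = x
Avoids-step (rec d)  (rec x)   = Avoids-step d (Avoids-sub instantiate x)
  where
  instantiate : ∀ i → Avoids _ (sub₀ _ i)
  instantiate zero = rec x
Avoids-step (sumL d) (sum x y) = Avoids-step d x
Avoids-step (sumR d) (sum x y) = Avoids-step d y

Avoids⇒¬⇒ : ∀ {k v s} {M : Mon k 0} → Avoids v M → ¬ M =[ s ]⇒ verd v
Avoids⇒¬⇒ (verd x) done       = x refl
Avoids⇒¬⇒ x        (step d p) = Avoids⇒¬⇒ (Avoids-step d x) p

Avoids⇒¬reaches : ∀ {k v} {M : Mon k 0} → Avoids v M → ∀ f → ¬ reaches v M f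
Avoids⇒¬reaches x (fin s) p       = Avoids⇒¬⇒ x p
Avoids⇒¬reaches x (inf g) (n , p) = Avoids⇒¬⇒ x p

Prefix : ∀ {k} → List (Fin k) → Trace k → Set
Prefix []          t = U.⊤
Prefix {k} (a ∷ s) t = Σ (Trace k) λ t′ → (uncons t ≡ just (a , t′)) × Prefix s t′

fin-Prefix : ∀ {k} (s : List (Fin k)) → Prefix s (fin s)
fin-Prefix []      = U.tt
fin-Prefix (a ∷ s) = fin s , refl , fin-Prefix s

takeω-Prefix : ∀ {k} n (g : ℕ → Fin k) → Prefix (takeω n g) (inf g)
takeω-Prefix zero    g = U.tt
takeω-Prefix (suc n) g = inf (λ i → g (suc i)) , refl , takeω-Prefix n (λ i → g (suc i))

-- Monitor synthesis and soundness

synthS : ∀ {k n} → Form k n → Mon k n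
synthS tt        = verd end
synthS ff        = verd no
synthS (φ ∨ ψ)   = verd end
synthS (φ ∧ ψ)   = synthS φ ⊕ synthS ψ
synthS (⟨ a ⟩ φ) = verd end
synthS ([ a ] φ) = a · synthS φ
synthS (mu φ)    = verd end
synthS (nu φ)    = rec (synthS φ)
synthS (var i)   = mvar i

synthC : ∀ {k n} → Form k n → Mon k n
synthC tt        = verd yes
synthC ff        = verd end
synthC (φ ∨ ψ)   = synthC φ ⊕ synthC ψ
synthC (φ ∧ ψ)   = verd end
synthC (⟨ a ⟩ φ) = a · synthC φ
synthC ([ a ] φ) = verd end
synthC (mu φ)    = rec (synthC φ)
synthC (nu φ)    = verd end
synthC (var i)   = mvar i

synthS-avoids-yes : ∀ {k n} (ψ : Form k n) → Avoids yes (synthS ψ)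
synthS-avoids-yes tt        = verd λ ()
synthS-avoids-yes ff        = verd λ ()
synthS-avoids-yes (φ ∨ ψ)   = verd λ ()
synthS-avoids-yes (φ ∧ ψ)   = sum (synthS-avoids-yes φ) (synthS-avoids-yes ψ)
synthS-avoids-yes (⟨ a ⟩ φ) = verd λ ()
synthS-avoids-yes ([ a ] φ) = act (synthS-avoids-yes φ)
synthS-avoids-yes (mu φ)    = verd λ ()
synthS-avoids-yes (nu φ)    = rec (synthS-avoids-yes φ)
synthS-avoids-yes (var i)   = mvar

synthC-avoids-no : ∀ {k n} (ψ : Form k n) → Avoids no (synthC ψ)
synthC-avoids-no tt        = verd λ ()
synthC-avoids-no ff        = verd λ ()
synthC-avoids-no (φ ∨ ψ)   = sum (synthC-avoids-no φ) (synthC-avoids-no ψ)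
synthC-avoids-no (φ ∧ ψ)   = verd λ ()
synthC-avoids-no (⟨ a ⟩ φ) = act (synthC-avoids-no φ)
synthC-avoids-no ([ a ] φ) = verd λ ()
synthC-avoids-no (mu φ)    = rec (synthC-avoids-no φ)
synthC-avoids-no (nu φ)    = verd λ ()
synthC-avoids-no (var i)   = mvar

data Unguarded {k : ℕ} : ∀ {n} → Fin n → Form k n → Set where
  here : ∀ {n} {i : Fin n} → Unguarded i (var i)
  ∧l   : ∀ {n i} {φ ψ : Form k n} → Unguarded i φ → Unguarded i (φ ∧ ψ)
  ∧r   : ∀ {n i} {φ ψ : Form k n} → Unguarded i ψ → Unguarded i (φ ∧ ψ)
  ∨l   : ∀ {n i} {φ ψ : Form k n} → Unguarded i φ → Unguarded i (φ ∨ ψ)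
  ∨r   : ∀ {n i} {φ ψ : Form k n} → Unguarded i ψ → Unguarded i (φ ∨ ψ)
  mu   : ∀ {n i} {φ : Form k (suc n)} → Unguarded (suc i) φ → Unguarded i (mu φ)
  nu   : ∀ {n i} {φ : Form k (suc n)} → Unguarded (suc i) φ → Unguarded i (nu φ)

GuardedVar⇒¬Unguarded : ∀ {k n} {i : Fin n} {ψ : Form k n} → GuardedVar i ψ → ¬ Unguarded i ψ
GuardedVar⇒¬Unguarded g       here   = g refl
GuardedVar⇒¬Unguarded (g , _) (∧l u) = GuardedVar⇒¬Unguarded g u
GuardedVar⇒¬Unguarded (_ , g) (∧r u) = GuardedVar⇒¬Unguarded g u
GuardedVar⇒¬Unguarded (g , _) (∨l u) = GuardedVar⇒¬Unguarded g u
GuardedVar⇒¬Unguarded (_ , g) (∨r u) = GuardedVar⇒¬Unguarded g u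
GuardedVar⇒¬Unguarded g       (mu u) = GuardedVar⇒¬Unguarded g u
GuardedVar⇒¬Unguarded g       (nu u) = GuardedVar⇒¬Unguarded g u

module _ {k : ℕ} where

  Unrefuted : ∀ {ℓ} → Mon k 0 → (Trace k → Set ℓ) → List (Fin k) → Set ℓ
  Unrefuted M P s = ∀ t → Prefix s t → P t → ¬ ShowsAfter no M s

  -- Entries of σ are sound for ρ on strictly shorter traces, and on traces of the current
  -- length for the variables occurring unguarded in ψ: a guarded variable is only consulted
  -- after at least one more action has been consumed.
  EnvUnrefuted : ∀ {n} → (Fin n → Mon k 0) → Env k n → ℕ → Set
  EnvUnrefuted σ ρ L = ∀ i s → length s < L → Unrefuted (σ i) (ρ i) s

  UnguardedUnrefuted : ∀ {n} → Form k n → (Fin n → Mon k 0) → Env k n → ℕ → Set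
  UnguardedUnrefuted ψ σ ρ L = ∀ i → Unguarded i ψ → ∀ s → length s ≤ L → Unrefuted (σ i) (ρ i) s

  synthS-sound : (L : ℕ) → ∀ {n} (ψ : Form k n) → IsS ψ → Guarded ψ →
    (σ : Fin n → Mon k 0) (ρ : Env k n) (s : List (Fin k)) → length s ≤ L →
    EnvUnrefuted σ ρ (length s) → UnguardedUnrefuted ψ σ ρ (length s) →
    Unrefuted (sub σ (synthS ψ)) (⟦ ψ ⟧ ρ) s
  synthS-sound L tt tt g σ ρ s s≤L hσ hψ t pre sat (_ , p , x) with verd-⇒ p | x
  ... | refl | ()
  synthS-sound L ff ff g σ ρ s s≤L hσ hψ t pre (lift ())
  synthS-sound L ([ a ] χ) (box a h) g σ ρ [] s≤L hσ hψ t pre sat (_ , done , ())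
  synthS-sound L ([ a ] χ) (box a h) g σ ρ (a ∷ s) s≤L hσ hψ t (t′ , t≡at′ , pre) sat (_ , step act p , x) =
    synthS-sound L χ h g σ ρ s (≤-trans (n≤1+n _) s≤L) hσ′ hχ t′ pre (sat t′ t≡at′) (_ , p , x)
    where
    hσ′ : EnvUnrefuted σ ρ (length s)
    hσ′ i s′ lt = hσ i s′ (m<n⇒m<1+n lt)
    hχ : UnguardedUnrefuted χ σ ρ (length s)
    hχ i _ s′ le = hσ i s′ (s≤s le)
  synthS-sound L (φ ∧ ψ) (and hφ hψ′) (gφ , gψ) σ ρ s s≤L hσ hψ t pre (satφ , satψ) p
    with ShowsAfter-⊕⁻ p
  ... | inj₁ pφ = synthS-sound L φ hφ gφ σ ρ s s≤L hσ (λ i u → hψ i (∧l u)) t pre satφ pφ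
  ... | inj₂ pψ = synthS-sound L ψ hψ′ gψ σ ρ s s≤L hσ (λ i u → hψ i (∧r u)) t pre satψ pψ
  synthS-sound L (nu φ) (nu h) (gv , gφ) σ ρ s s≤L hσ hψ t pre (P , post , Pt) p =
    synthS-sound L φ h gφ (R ∷ₛ σ) (extend P ρ) s s≤L hσ′ hφ t pre (post t Pt) p′
    where
    R : Mon k 0
    R = sub σ (synthS (nu φ))
    p′ : ShowsAfter no (sub (R ∷ₛ σ) (synthS φ)) s
    p′ = subst (λ M → ShowsAfter no M s) (sub-extS-[]₀ R σ (synthS φ)) (ShowsAfter-rec⁻ p)
    R-unrefuted : ∀ L′ s′ → length s′ < length s → length s ≤ L′ → Unrefuted R P s′
    R-unrefuted zero s′ lt le with ≤-trans lt le
    ... | ()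
    R-unrefuted (suc L′) s′ lt le u pre′ Pu =
      synthS-sound L′ (nu φ) (nu h) (gv , gφ) σ ρ s′ (≤-pred (≤-trans lt le))
        (λ i s″ lt″ → hσ i s″ (<-trans lt″ lt)) (λ i _ s″ le″ → hσ i s″ (≤-<-trans le″ lt))
        u pre′ (P , post , Pu)
    hσ′ : EnvUnrefuted (R ∷ₛ σ) (extend P ρ) (length s)
    hσ′ zero    s′ lt = R-unrefuted L s′ lt s≤L
    hσ′ (suc i)       = hσ i
    hφ : UnguardedUnrefuted φ (R ∷ₛ σ) (extend P ρ) (length s)
    hφ zero    u = ⊥-elim (GuardedVar⇒¬Unguarded gv u)
    hφ (suc i) u = hψ i (nu u)
  synthS-sound L (var i) (var i) g σ ρ s s≤L hσ hψ t pre (lift sat) = hψ i here s ≤-refl t pre sat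

  Verified : ∀ {ℓ} → Mon k 0 → (Trace k → Set ℓ) → List (Fin k) → Set ℓ
  Verified M P s = ∀ t → Prefix s t → ShowsAfter yes M s → P t

  EnvVerified : ∀ {n} → (Fin n → Mon k 0) → Env k n → ℕ → Set
  EnvVerified σ ρ L = ∀ i s → length s < L → Verified (σ i) (ρ i) s

  UnguardedVerified : ∀ {n} → Form k n → (Fin n → Mon k 0) → Env k n → ℕ → Set
  UnguardedVerified ψ σ ρ L = ∀ i → Unguarded i ψ → ∀ s → length s ≤ L → Verified (σ i) (ρ i) s

  synthC-sound : (L : ℕ) → ∀ {n} (ψ : Form k n) → IsC ψ → Guarded ψ →
    (σ : Fin n → Mon k 0) (ρ : Env k n) (s : List (Fin k)) → length s ≤ L →
    EnvVerified σ ρ (length s) → UnguardedVerified ψ σ ρ (length s) →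
    Verified (sub σ (synthC ψ)) (⟦ ψ ⟧ ρ) s
  synthC-sound L tt tt g σ ρ s s≤L hσ hψ t pre p = lift U.tt
  synthC-sound L ff ff g σ ρ s s≤L hσ hψ t pre (_ , p , x) with verd-⇒ p | x
  ... | refl | ()
  synthC-sound L (⟨ a ⟩ χ) (dia a h) g σ ρ [] s≤L hσ hψ t pre (_ , done , ())
  synthC-sound L (⟨ a ⟩ χ) (dia a h) g σ ρ (a ∷ s) s≤L hσ hψ t (t′ , t≡at′ , pre) (_ , step act p , x) =
    t′ , t≡at′ , synthC-sound L χ h g σ ρ s (≤-trans (n≤1+n _) s≤L) hσ′ hχ t′ pre (_ , p , x)
    where
    hσ′ : EnvVerified σ ρ (length s)
    hσ′ i s′ lt = hσ i s′ (m<n⇒m<1+n lt)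
    hχ : UnguardedVerified χ σ ρ (length s)
    hχ i _ s′ le = hσ i s′ (s≤s le)
  synthC-sound L (φ ∨ ψ) (or hφ hψ′) (gφ , gψ) σ ρ s s≤L hσ hψ t pre p with ShowsAfter-⊕⁻ p
  ... | inj₁ pφ = inj₁ (synthC-sound L φ hφ gφ σ ρ s s≤L hσ (λ i u → hψ i (∨l u)) t pre pφ)
  ... | inj₂ pψ = inj₂ (synthC-sound L ψ hψ′ gψ σ ρ s s≤L hσ (λ i u → hψ i (∨r u)) t pre pψ)
  synthC-sound L (mu φ) (mu h) (gv , gφ) σ ρ s s≤L hσ hψ t pre p P pre-fix =
    pre-fix t (synthC-sound L φ h gφ (R ∷ₛ σ) (extend P ρ) s s≤L hσ′ hφ t pre p′)
    where
    R : Mon k 0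
    R = sub σ (synthC (mu φ))
    p′ : ShowsAfter yes (sub (R ∷ₛ σ) (synthC φ)) s
    p′ = subst (λ M → ShowsAfter yes M s) (sub-extS-[]₀ R σ (synthC φ)) (ShowsAfter-rec⁻ p)
    R-verified : ∀ L′ s′ → length s′ < length s → length s ≤ L′ → Verified R P s′
    R-verified zero s′ lt le with ≤-trans lt le
    ... | ()
    R-verified (suc L′) s′ lt le u pre′ q =
      synthC-sound L′ (mu φ) (mu h) (gv , gφ) σ ρ s′ (≤-pred (≤-trans lt le))
        (λ i s″ lt″ → hσ i s″ (<-trans lt″ lt)) (λ i _ s″ le″ → hσ i s″ (≤-<-trans le″ lt))
        u pre′ q P pre-fix
    hσ′ : EnvVerified (R ∷ₛ σ) (extend P ρ) (length s)
    hσ′ zero    s′ lt = R-verified L s′ lt s≤L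
    hσ′ (suc i)       = hσ i
    hφ : UnguardedVerified φ (R ∷ₛ σ) (extend P ρ) (length s)
    hφ zero    u = ⊥-elim (GuardedVar⇒¬Unguarded gv u)
    hφ (suc i) u = hψ i (mu u)
  synthC-sound L (var i) (var i) g σ ρ s s≤L hσ hψ t pre p = lift (hψ i here s ≤-refl t pre p)

-- `sub (envS C ψ ∅ₛ) (synthS ψ)` is the state the monitor of `plug C ψ` is in once it has
-- unfolded its way down to ψ: every binder of C is instantiated by the monitor of its fixpoint.
envS : ∀ {k n m} → Ctx k n m → Form k m → (Fin n → Mon k 0) → Fin m → Mon k 0
envS hole     ψ σ = σ
envS (∧ˡ C χ) ψ σ = envS C ψ σ
envS (∧ʳ χ C) ψ σ = envS C ψ σ
envS (∨ˡ C χ) ψ σ = envS C ψ σ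
envS (∨ʳ χ C) ψ σ = envS C ψ σ
envS (⟨⟩ a C) ψ σ = envS C ψ σ
envS ([] a C) ψ σ = envS C ψ σ
envS (muC C)  ψ σ = envS C ψ (sub σ (synthS (mu (plug C ψ))) ∷ₛ σ)
envS (nuC C)  ψ σ = envS C ψ (sub σ (synthS (nu (plug C ψ))) ∷ₛ σ)

NuBindersE : ∀ {k n m} → Ctx k n m → Form k m → Set
NuBindersE hole     ψ = U.⊤
NuBindersE (∧ˡ C χ) ψ = NuBindersE C ψ
NuBindersE (∧ʳ χ C) ψ = NuBindersE C ψ
NuBindersE (∨ˡ C χ) ψ = NuBindersE C ψ
NuBindersE (∨ʳ χ C) ψ = NuBindersE C ψ
NuBindersE (⟨⟩ a C) ψ = NuBindersE C ψ
NuBindersE ([] a C) ψ = NuBindersE C ψ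
NuBindersE (muC C)  ψ = NuBindersE C ψ
NuBindersE (nuC C)  ψ = IsE (nu (plug C ψ)) × NuBindersE C ψ

plug-⨾ : ∀ {k n m l} (C : Ctx k n m) (D : Ctx k m l) ψ → plug (C ⨾ D) ψ ≡ plug C (plug D ψ)
plug-⨾ hole     D ψ = refl
plug-⨾ (∧ˡ C χ) D ψ = cong (_∧ χ) (plug-⨾ C D ψ)
plug-⨾ (∧ʳ χ C) D ψ = cong (χ ∧_) (plug-⨾ C D ψ)
plug-⨾ (∨ˡ C χ) D ψ = cong (_∨ χ) (plug-⨾ C D ψ)
plug-⨾ (∨ʳ χ C) D ψ = cong (χ ∨_) (plug-⨾ C D ψ)
plug-⨾ (⟨⟩ a C) D ψ = cong (⟨ a ⟩_) (plug-⨾ C D ψ)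
plug-⨾ ([] a C) D ψ = cong ([ a ]_) (plug-⨾ C D ψ)
plug-⨾ (muC C)  D ψ = cong mu (plug-⨾ C D ψ)
plug-⨾ (nuC C)  D ψ = cong nu (plug-⨾ C D ψ)

envS-cong : ∀ {k n m} (C : Ctx k n m) ψ {σ τ : Fin n → Mon k 0} → σ ≗ τ → envS C ψ σ ≗ envS C ψ τ
envS-cong hole     ψ e = e
envS-cong (∧ˡ C χ) ψ e = envS-cong C ψ e
envS-cong (∧ʳ χ C) ψ e = envS-cong C ψ e
envS-cong (∨ˡ C χ) ψ e = envS-cong C ψ e
envS-cong (∨ʳ χ C) ψ e = envS-cong C ψ e
envS-cong (⟨⟩ a C) ψ e = envS-cong C ψ e
envS-cong ([] a C) ψ e = envS-cong C ψ e
envS-cong (muC C)  ψ {σ} {τ} e = envS-cong C ψ ext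
  where
  ext : sub σ (synthS (mu (plug C ψ))) ∷ₛ σ ≗ sub τ (synthS (mu (plug C ψ))) ∷ₛ τ
  ext zero    = sub-cong e (synthS (mu (plug C ψ)))
  ext (suc j) = e j
envS-cong (nuC C)  ψ {σ} {τ} e = envS-cong C ψ ext
  where
  ext : sub σ (synthS (nu (plug C ψ))) ∷ₛ σ ≗ sub τ (synthS (nu (plug C ψ))) ∷ₛ τ
  ext zero    = sub-cong e (synthS (nu (plug C ψ)))
  ext (suc j) = e j

envS-⨾ : ∀ {k n m l} (C : Ctx k n m) (D : Ctx k m l) ψ σ →
         envS (C ⨾ D) ψ σ ≗ envS D ψ (envS C (plug D ψ) σ)
envS-⨾ hole     D ψ σ = λ _ → refl
envS-⨾ (∧ˡ C χ) D ψ σ = envS-⨾ C D ψ σ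
envS-⨾ (∧ʳ χ C) D ψ σ = envS-⨾ C D ψ σ
envS-⨾ (∨ˡ C χ) D ψ σ = envS-⨾ C D ψ σ
envS-⨾ (∨ʳ χ C) D ψ σ = envS-⨾ C D ψ σ
envS-⨾ (⟨⟩ a C) D ψ σ = envS-⨾ C D ψ σ
envS-⨾ ([] a C) D ψ σ = envS-⨾ C D ψ σ
envS-⨾ (muC C)  D ψ σ j =
  trans (envS-⨾ C D ψ _ j) (envS-cong D ψ (envS-cong C (plug D ψ) binder) j)
  where
  binder : sub σ (synthS (mu (plug (C ⨾ D) ψ))) ∷ₛ σ ≗ sub σ (synthS (mu (plug C (plug D ψ)))) ∷ₛ σ
  binder zero    = cong (λ χ → sub σ (synthS (mu χ))) (plug-⨾ C D ψ)
  binder (suc i) = refl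
envS-⨾ (nuC C)  D ψ σ j =
  trans (envS-⨾ C D ψ _ j) (envS-cong D ψ (envS-cong C (plug D ψ) binder) j)
  where
  binder : sub σ (synthS (nu (plug (C ⨾ D) ψ))) ∷ₛ σ ≗ sub σ (synthS (nu (plug C (plug D ψ)))) ∷ₛ σ
  binder zero    = cong (λ χ → sub σ (synthS (nu χ))) (plug-⨾ C D ψ)
  binder (suc i) = refl

envS-liftVar : ∀ {k n m} (E : Ctx k n m) ψ σ i → envS E ψ σ (liftVar E i) ≡ σ i
envS-liftVar hole     ψ σ i = refl
envS-liftVar (∧ˡ C χ) ψ σ i = envS-liftVar C ψ σ i
envS-liftVar (∧ʳ χ C) ψ σ i = envS-liftVar C ψ σ i
envS-liftVar (∨ˡ C χ) ψ σ i = envS-liftVar C ψ σ i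
envS-liftVar (∨ʳ χ C) ψ σ i = envS-liftVar C ψ σ i
envS-liftVar (⟨⟩ a C) ψ σ i = envS-liftVar C ψ σ i
envS-liftVar ([] a C) ψ σ i = envS-liftVar C ψ σ i
envS-liftVar (muC C)  ψ σ i = envS-liftVar C ψ _ (suc i)
envS-liftVar (nuC C)  ψ σ i = envS-liftVar C ψ _ (suc i)

NuBindersE-⨾ : ∀ {k n m l} (C : Ctx k n m) (D : Ctx k m l) ψ →
               NuBindersE C (plug D ψ) → NuBindersE D ψ → NuBindersE (C ⨾ D) ψ
NuBindersE-⨾ hole     D ψ bC bD = bD
NuBindersE-⨾ (∧ˡ C χ) D ψ bC bD = NuBindersE-⨾ C D ψ bC bD
NuBindersE-⨾ (∧ʳ χ C) D ψ bC bD = NuBindersE-⨾ C D ψ bC bD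
NuBindersE-⨾ (∨ˡ C χ) D ψ bC bD = NuBindersE-⨾ C D ψ bC bD
NuBindersE-⨾ (∨ʳ χ C) D ψ bC bD = NuBindersE-⨾ C D ψ bC bD
NuBindersE-⨾ (⟨⟩ a C) D ψ bC bD = NuBindersE-⨾ C D ψ bC bD
NuBindersE-⨾ ([] a C) D ψ bC bD = NuBindersE-⨾ C D ψ bC bD
NuBindersE-⨾ (muC C)  D ψ bC bD = NuBindersE-⨾ C D ψ bC bD
NuBindersE-⨾ (nuC C)  D ψ (e , bC) bD =
  subst (λ χ → IsE (nu χ)) (sym (plug-⨾ C D ψ)) e , NuBindersE-⨾ C D ψ bC bD

IsS-plug⁻ : ∀ {k n m} (C : Ctx k n m) {ψ} → IsS (plug C ψ) → IsS ψ
IsS-plug⁻ hole     h         = h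
IsS-plug⁻ (∧ˡ C χ) (and h _) = IsS-plug⁻ C h
IsS-plug⁻ (∧ʳ χ C) (and _ h) = IsS-plug⁻ C h
IsS-plug⁻ ([] a C) (box _ h) = IsS-plug⁻ C h
IsS-plug⁻ (nuC C)  (nu h)    = IsS-plug⁻ C h

Guarded-plug⁻ : ∀ {k n m} (C : Ctx k n m) {ψ} → Guarded (plug C ψ) → Guarded ψ
Guarded-plug⁻ hole     g       = g
Guarded-plug⁻ (∧ˡ C χ) (g , _) = Guarded-plug⁻ C g
Guarded-plug⁻ (∧ʳ χ C) (_ , g) = Guarded-plug⁻ C g
Guarded-plug⁻ (∨ˡ C χ) (g , _) = Guarded-plug⁻ C g
Guarded-plug⁻ (∨ʳ χ C) (_ , g) = Guarded-plug⁻ C g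
Guarded-plug⁻ (⟨⟩ a C) g       = Guarded-plug⁻ C g
Guarded-plug⁻ ([] a C) g       = Guarded-plug⁻ C g
Guarded-plug⁻ (muC C)  (_ , g) = Guarded-plug⁻ C g
Guarded-plug⁻ (nuC C)  (_ , g) = Guarded-plug⁻ C g

Refutable : ∀ {k} → Mon k 0 → Set
Refutable {k} M = Σ (List (Fin k)) λ w → ShowsAfter no M w

Refutable-⊕ˡ : ∀ {k} {M N : Mon k 0} → Refutable M → Refutable (M ⊕ N)
Refutable-⊕ˡ (w , p) = w , ShowsAfter-⊕ˡ p

Refutable-⊕ʳ : ∀ {k} {M N : Mon k 0} → Refutable N → Refutable (M ⊕ N)
Refutable-⊕ʳ (w , p) = w , ShowsAfter-⊕ʳ p

Refutable-· : ∀ {k a} {M : Mon k 0} → Refutable M → Refutable (a · M)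
Refutable-· (w , p) = _ , ShowsAfter-· p

Refutable-rec : ∀ {k n} (σ : Fin n → Mon k 0) (M : Mon k (suc n)) →
                Refutable (sub (sub σ (rec M) ∷ₛ σ) M) → Refutable (sub σ (rec M))
Refutable-rec σ M (w , p) =
  w , ShowsAfter-rec⁺ (subst (λ N → ShowsAfter no N w) (sym (sub-extS-[]₀ _ σ M)) p)

ff-refutable : ∀ {k n} {ψ : Form k n} → Occurs {k} ff ψ → IsS ψ → ∀ σ → Refutable (sub σ (synthS ψ))
ff-refutable here    ff          σ = [] , verd no , done , verd
ff-refutable (∧l o)  (and h _)   σ = Refutable-⊕ˡ (ff-refutable o h σ)
ff-refutable (∧r o)  (and _ h)   σ = Refutable-⊕ʳ (ff-refutable o h σ)
ff-refutable (box o) (box _ h)   σ = Refutable-· (ff-refutable o h σ)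
ff-refutable (nu {φ = φ} o) (nu h) σ = Refutable-rec σ (synthS φ) (ff-refutable o h _)

var-refutable : ∀ {k n} {i} {ψ : Form k n} → FreeIn i ψ → IsS ψ →
                ∀ σ → Refutable (σ i) → Refutable (sub σ (synthS ψ))
var-refutable here    _         σ r = r
var-refutable (∧l o)  (and h _) σ r = Refutable-⊕ˡ (var-refutable o h σ r)
var-refutable (∧r o)  (and _ h) σ r = Refutable-⊕ʳ (var-refutable o h σ r)
var-refutable (box o) (box _ h) σ r = Refutable-· (var-refutable o h σ r)
var-refutable (nu {φ = φ} o) (nu h) σ r = Refutable-rec σ (synthS φ) (var-refutable o h _ r)

-- A subformula refuting in j+1 unfoldings mentions the variable of a ν-binder refuting in j
-- unfoldings, and that variable is instantiated by the monitor of the binder.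
canRefute⇒refutable : ∀ {k} j {m} (C : Ctx k 0 m) ψ → IsS (plug C ψ) → CanRefuteIn j C ψ →
                      Refutable (sub (envS C ψ ∅ₛ) (synthS ψ))
canRefute⇒refutable zero    C ψ h o        = ff-refutable o (IsS-plug⁻ C h) _
canRefute⇒refutable (suc j) C ψ h (inj₁ r) = canRefute⇒refutable j C ψ h r
canRefute⇒refutable (suc j) .(D ⨾ nuC E) ψ h (inj₂ (d , D , E , refl , free , r)) =
  var-refutable free (IsS-plug⁻ (D ⨾ nuC E) h) _ binder-refutable
  where
  binder-refutable : Refutable (envS (D ⨾ nuC E) ψ ∅ₛ (liftVar E zero))
  binder-refutable =
    subst Refutable (sym (trans (envS-⨾ D (nuC E) ψ ∅ₛ (liftVar E zero)) (envS-liftVar E ψ _ zero)))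
      (canRefute⇒refutable j D (nu (plug E ψ)) (subst IsS (plug-⨾ D (nuC E) ψ) h) r)

record Branch {k n} (l : List (Fin k)) (φs : Fin k → Form k n) (a : Fin k) : Set where
  field
    ctx     : Ctx k n n
    plug≡   : plug ctx (φs a) ≡ bigAnd l φs
    envS-id : ∀ τ → envS ctx (φs a) τ ≗ τ
    binders : NuBindersE ctx (φs a)
    step-in : ∀ σ → sub σ (synthS (bigAnd l φs)) —[ a ]→ sub σ (synthS (φs a))

bigAnd-branch : ∀ {k n} (l : List (Fin k)) (φs : Fin k → Form k n) {a : Fin k} → a ∈ l → Branch l φs a
bigAnd-branch (x ∷ [])    φs (here refl) = record
  { ctx = [] x hole ; plug≡ = refl ; envS-id = λ _ _ → refl ; binders = U.tt ; step-in = λ _ → act }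
bigAnd-branch (x ∷ y ∷ l) φs (here refl) = record
  { ctx = ∧ˡ ([] x hole) (bigAnd (y ∷ l) φs) ; plug≡ = refl ; envS-id = λ _ _ → refl
  ; binders = U.tt ; step-in = λ _ → sumL act }
bigAnd-branch (x ∷ y ∷ l) φs (there a∈l) = record
  { ctx = ∧ʳ ([ x ] φs x) ctx ; plug≡ = cong (([ x ] φs x) ∧_) plug≡ ; envS-id = envS-id
  ; binders = binders ; step-in = λ σ → sumR (step-in σ) }
  where open Branch (bigAnd-branch (y ∷ l) φs a∈l)

-- Persistence

module Persistence {k : ℕ} (φ₁ : Form k 0) (hS : IsS φ₁) (hG : Guarded φ₁) (hR : AllCanRefute φ₁) where

  AtOccurrence : Mon k 0 → Set
  AtOccurrence M = Σ ℕ λ m → Σ (Ctx k 0 m) λ C → Σ (Form k m) λ ψ →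
    (plug C ψ ≡ φ₁) × IsE ψ × NuBindersE C ψ × (M ≡ sub (envS C ψ ∅ₛ) (synthS ψ))

  Progresses : Mon k 0 → Set
  Progresses M = ∀ a → Σ (Mon k 0) λ M′ → (M —[ a ]→ M′) × AtOccurrence M′

  Progresses-mono : ∀ {M N : Mon k 0} → (∀ {a M′} → N —[ a ]→ M′ → M —[ a ]→ M′) →
                    Progresses N → Progresses M
  Progresses-mono N⊆M pN a with pN a
  ... | M′ , d , at = M′ , N⊆M d , at

  IsS-at : ∀ {m} (C : Ctx k 0 m) {ψ} → plug C ψ ≡ φ₁ → IsS ψ
  IsS-at C eq = IsS-plug⁻ C (subst IsS (sym eq) hS)

  Guarded-at : ∀ {m} (C : Ctx k 0 m) {ψ} → plug C ψ ≡ φ₁ → Guarded ψ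
  Guarded-at C eq = Guarded-plug⁻ C (subst Guarded (sym eq) hG)

  -- Only the empty disjunction ff (when there are no actions) lies in sHML.
  bigOr-progresses : ∀ {m} (l : List (Fin k)) {φs : Fin k → Form k m} (C : Ctx k 0 m) →
    plug C (bigOr l φs) ≡ φ₁ → IsE (bigOr l φs) → NuBindersE C (bigOr l φs) →
    Progresses (sub (envS C (bigOr l φs) ∅ₛ) (synthS (bigOr l φs)))
  bigOr-progresses []          C eq e b a = verd no , verd , (_ , C , _ , eq , e , b , refl)
  bigOr-progresses (x ∷ [])    C eq e b with IsS-at C eq
  ... | ()
  bigOr-progresses (x ∷ y ∷ l) C eq e b with IsS-at C eq
  ... | ()

  progresses : ∀ {m} (C : Ctx k 0 m) (ψ : Form k m) → plug C ψ ≡ φ₁ → IsE ψ → NuBindersE C ψ →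
    (∀ j → Unguarded j ψ → Progresses (envS C ψ ∅ₛ j)) → Progresses (sub (envS C ψ ∅ₛ) (synthS ψ))
  progresses C .tt eq tt b H a = verd end , verd , (_ , C , tt , eq , tt , b , refl)
  progresses C .ff eq ff b H a = verd no , verd , (_ , C , ff , eq , ff , b , refl)
  progresses C (mu φ) eq (mu e) b H with IsS-at C eq
  ... | ()
  progresses C (φ ∨ ψ) eq (or _ _) b H with IsS-at C eq
  ... | ()
  progresses C (var i) eq (var i) b H = H i here
  progresses {m} C (nu φ) eq (nu e) b H =
    Progresses-mono (λ d → rec (subst (λ X → X —[ _ ]→ _) (sym unfold≡) d)) (progresses C′ φ eq′ e b′ H′)
    where
    σ : Fin m → Mon k 0
    σ = envS C (nu φ) ∅ₛ
    C′ : Ctx k 0 (suc m)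
    C′ = C ⨾ nuC hole
    body-env : envS C′ φ ∅ₛ ≗ sub σ (synthS (nu φ)) ∷ₛ σ
    body-env = envS-⨾ C (nuC hole) φ ∅ₛ
    unfold≡ : sub (extS σ) (synthS φ) [ sub σ (synthS (nu φ)) ]₀ ≡ sub (envS C′ φ ∅ₛ) (synthS φ)
    unfold≡ = trans (sub-extS-[]₀ _ σ (synthS φ)) (sub-cong (λ j → sym (body-env j)) (synthS φ))
    eq′ : plug C′ φ ≡ φ₁
    eq′ = trans (plug-⨾ C (nuC hole) φ) eq
    b′ : NuBindersE C′ φ
    b′ = NuBindersE-⨾ C (nuC hole) φ b (nu e , U.tt)
    H′ : ∀ j → Unguarded j φ → Progresses (envS C′ φ ∅ₛ j)
    H′ zero    u = ⊥-elim (GuardedVar⇒¬Unguarded (proj₁ (Guarded-at C eq)) u)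
    H′ (suc i) u = subst Progresses (sym (body-env (suc i))) (H i (nu u))
  progresses {m} C (φ ∧ ψ) eq (and e _) b H =
    Progresses-mono (λ d → sumL (subst (λ X → X —[ _ ]→ _) (sub-cong env≡ (synthS φ)) d))
      (progresses C′ φ eq′ e b′ H′)
    where
    C′ : Ctx k 0 m
    C′ = C ⨾ ∧ˡ hole ψ
    env≡ : envS C′ φ ∅ₛ ≗ envS C (φ ∧ ψ) ∅ₛ
    env≡ = envS-⨾ C (∧ˡ hole ψ) φ ∅ₛ
    eq′ : plug C′ φ ≡ φ₁
    eq′ = trans (plug-⨾ C (∧ˡ hole ψ) φ) eq
    b′ : NuBindersE C′ φ
    b′ = NuBindersE-⨾ C (∧ˡ hole ψ) φ b U.tt
    H′ : ∀ j → Unguarded j φ → Progresses (envS C′ φ ∅ₛ j)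
    H′ j u = subst Progresses (sym (env≡ j)) (H j (∧l u))
  progresses C .(⋁⟨⟩ φs) eq (bigOrE φs h) b H = bigOr-progresses (allFin k) C eq (bigOrE φs h) b
  progresses {m} C .(⋀[] φs) eq (bigAndE φs h) b H a =
    sub σ (synthS (φs a)) , step-in σ ,
    (_ , C ⨾ ctx , φs a , eq′ , h a , b′ , sub-cong (λ j → sym (env≡ j)) (synthS (φs a)))
    where
    open Branch (bigAnd-branch (allFin k) φs (∈-allFin a))
    σ : Fin m → Mon k 0
    σ = envS C (⋀[] φs) ∅ₛ
    eq′ : plug (C ⨾ ctx) (φs a) ≡ φ₁
    eq′ = trans (plug-⨾ C ctx (φs a)) (trans (cong (plug C) plug≡) eq)
    b′ : NuBindersE (C ⨾ ctx) (φs a)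
    b′ = NuBindersE-⨾ C ctx (φs a) (subst (NuBindersE C) (sym plug≡) b) binders
    env≡ : envS (C ⨾ ctx) (φs a) ∅ₛ ≗ σ
    env≡ j = trans (envS-⨾ C ctx (φs a) ∅ₛ j) (trans (envS-id _ j) (cong (λ χ → envS C χ ∅ₛ j) plug≡))

  -- Progress of the substitution entries is carried down C below the prefix P; at a ν-binder
  -- the new entry is the monitor of an occurrence, so `progresses` applies to it.
  DescendsProgress : ∀ {n m} → Ctx k 0 n → Ctx k n m → Form k m → Set
  DescendsProgress P C ψ =
    plug P (plug C ψ) ≡ φ₁ → NuBindersE P (plug C ψ) → NuBindersE C ψ →
    (∀ j → Progresses (envS P (plug C ψ) ∅ₛ j)) →
    ∀ j → Progresses (envS C ψ (envS P (plug C ψ) ∅ₛ) j)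

  through-layer : ∀ {n m} (P : Ctx k 0 n) (Y : Ctx k n n) (C : Ctx k n m) ψ →
    (∀ χ τ → envS Y χ τ ≗ τ) → (∀ χ → NuBindersE Y χ) → DescendsProgress (P ⨾ Y) C ψ →
    plug P (plug Y (plug C ψ)) ≡ φ₁ → NuBindersE P (plug Y (plug C ψ)) → NuBindersE C ψ →
    (∀ j → Progresses (envS P (plug Y (plug C ψ)) ∅ₛ j)) →
    ∀ j → Progresses (envS C ψ (envS P (plug Y (plug C ψ)) ∅ₛ) j)
  through-layer P Y C ψ Y-id Y-binders below eq bP bC hP j =
    subst Progresses (envS-cong C ψ env≡ j) (below eq′ bPY bC hPY j)
    where
    χ : Form k _
    χ = plug C ψ
    env≡ : envS (P ⨾ Y) χ ∅ₛ ≗ envS P (plug Y χ) ∅ₛ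
    env≡ i = trans (envS-⨾ P Y χ ∅ₛ i) (Y-id χ _ i)
    eq′ : plug (P ⨾ Y) χ ≡ φ₁
    eq′ = trans (plug-⨾ P Y χ) eq
    bPY : NuBindersE (P ⨾ Y) χ
    bPY = NuBindersE-⨾ P Y χ bP (Y-binders χ)
    hPY : ∀ i → Progresses (envS (P ⨾ Y) χ ∅ₛ i)
    hPY i = subst Progresses (sym (env≡ i)) (hP i)

  env-progresses : ∀ {n m} (P : Ctx k 0 n) (C : Ctx k n m) (ψ : Form k m) → DescendsProgress P C ψ
  env-progresses P hole     ψ eq bP bC hP = hP
  env-progresses P (∧ˡ C χ) ψ =
    through-layer P (∧ˡ hole χ) C ψ (λ _ _ _ → refl) (λ _ → U.tt) (env-progresses (P ⨾ ∧ˡ hole χ) C ψ)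
  env-progresses P (∧ʳ χ C) ψ =
    through-layer P (∧ʳ χ hole) C ψ (λ _ _ _ → refl) (λ _ → U.tt) (env-progresses (P ⨾ ∧ʳ χ hole) C ψ)
  env-progresses P (∨ˡ C χ) ψ =
    through-layer P (∨ˡ hole χ) C ψ (λ _ _ _ → refl) (λ _ → U.tt) (env-progresses (P ⨾ ∨ˡ hole χ) C ψ)
  env-progresses P (∨ʳ χ C) ψ =
    through-layer P (∨ʳ χ hole) C ψ (λ _ _ _ → refl) (λ _ → U.tt) (env-progresses (P ⨾ ∨ʳ χ hole) C ψ)
  env-progresses P (⟨⟩ a C) ψ =
    through-layer P (⟨⟩ a hole) C ψ (λ _ _ _ → refl) (λ _ → U.tt) (env-progresses (P ⨾ ⟨⟩ a hole) C ψ)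
  env-progresses P ([] a C) ψ =
    through-layer P ([] a hole) C ψ (λ _ _ _ → refl) (λ _ → U.tt) (env-progresses (P ⨾ [] a hole) C ψ)
  env-progresses P (muC C)  ψ eq _ _ _ with IsS-at P eq
  ... | ()
  env-progresses P (nuC C)  ψ eq bP (e , bC) hP j =
    subst Progresses (envS-cong C ψ env≡ j) (env-progresses P′ C ψ eq′ bP′ bC hP′ j)
    where
    χ : Form k _
    χ = plug C ψ
    σ : Fin _ → Mon k 0
    σ = envS P (nu χ) ∅ₛ
    P′ : Ctx k 0 _
    P′ = P ⨾ nuC hole
    env≡ : envS P′ χ ∅ₛ ≗ sub σ (synthS (nu χ)) ∷ₛ σ
    env≡ = envS-⨾ P (nuC hole) χ ∅ₛ
    eq′ : plug P′ χ ≡ φ₁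
    eq′ = trans (plug-⨾ P (nuC hole) χ) eq
    bP′ : NuBindersE P′ χ
    bP′ = NuBindersE-⨾ P (nuC hole) χ bP (e , U.tt)
    hP-ext : ∀ i → Progresses ((sub σ (synthS (nu χ)) ∷ₛ σ) i)
    hP-ext zero    = progresses P (nu χ) eq e bP (λ i _ → hP i)
    hP-ext (suc i) = hP i
    hP′ : ∀ i → Progresses (envS P′ χ ∅ₛ i)
    hP′ i = subst Progresses (sym (env≡ i)) (hP-ext i)

  atOccurrence-progresses : ∀ {M} → AtOccurrence M → Progresses M
  atOccurrence-progresses (_ , C , ψ , eq , e , b , refl) =
    progresses C ψ eq e b (λ j _ → env-progresses hole C ψ eq U.tt b (λ ()) j)

  atOccurrence-refutable : ∀ {M} → AtOccurrence M → Refutable M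
  atOccurrence-refutable (_ , C , ψ , eq , _ , _ , refl) with hR C ψ eq
  ... | j , r = canRefute⇒refutable j C ψ (subst IsS (sym eq) hS) r

  atOccurrence-persistent : ∀ s {M} → AtOccurrence M → Σ (List (Fin k)) λ w → ShowsAfter no M (s ++ w)
  atOccurrence-persistent []      at = atOccurrence-refutable at
  atOccurrence-persistent (a ∷ s) at with atOccurrence-progresses at a
  ... | M′ , d , at′ with atOccurrence-persistent s at′
  ... | w , M″ , p , x = w , M″ , step d p , x

synthS-persistent : ∀ {k} (φ : Form k 0) → IsS φ → Guarded φ → IsE φ → AllCanRefute φ →
  ∀ s → Σ (List (Fin k)) λ w → ShowsAfter no (sub ∅ₛ (synthS φ)) (s ++ w)
synthS-persistent φ hS hG hE hR s = atOccurrence-persistent s (0 , hole , φ , refl , hE , U.tt , refl)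
  where open Persistence φ hS hG hR

-- Duality

dual : ∀ {k n} → Form k n → Form k n
dual tt        = ff
dual ff        = tt
dual (φ ∨ ψ)   = dual φ ∧ dual ψ
dual (φ ∧ ψ)   = dual φ ∨ dual ψ
dual (⟨ a ⟩ φ) = [ a ] dual φ
dual ([ a ] φ) = ⟨ a ⟩ dual φ
dual (mu φ)    = nu (dual φ)
dual (nu φ)    = mu (dual φ)
dual (var i)   = var i

dualC : ∀ {k n m} → Ctx k n m → Ctx k n m
dualC hole     = hole
dualC (∧ˡ C χ) = ∨ˡ (dualC C) (dual χ)
dualC (∧ʳ χ C) = ∨ʳ (dual χ) (dualC C)
dualC (∨ˡ C χ) = ∧ˡ (dualC C) (dual χ)
dualC (∨ʳ χ C) = ∧ʳ (dual χ) (dualC C)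
dualC (⟨⟩ a C) = [] a (dualC C)
dualC ([] a C) = ⟨⟩ a (dualC C)
dualC (muC C)  = nuC (dualC C)
dualC (nuC C)  = muC (dualC C)

dual-involutive : ∀ {k n} (φ : Form k n) → dual (dual φ) ≡ φ
dual-involutive tt        = refl
dual-involutive ff        = refl
dual-involutive (φ ∨ ψ)   = cong₂ _∨_ (dual-involutive φ) (dual-involutive ψ)
dual-involutive (φ ∧ ψ)   = cong₂ _∧_ (dual-involutive φ) (dual-involutive ψ)
dual-involutive (⟨ a ⟩ φ) = cong (⟨ a ⟩_) (dual-involutive φ)
dual-involutive ([ a ] φ) = cong ([ a ]_) (dual-involutive φ)
dual-involutive (mu φ)    = cong mu (dual-involutive φ)
dual-involutive (nu φ)    = cong nu (dual-involutive φ)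
dual-involutive (var i)   = refl

dualC-involutive : ∀ {k n m} (C : Ctx k n m) → dualC (dualC C) ≡ C
dualC-involutive hole     = refl
dualC-involutive (∧ˡ C χ) = cong₂ ∧ˡ (dualC-involutive C) (dual-involutive χ)
dualC-involutive (∧ʳ χ C) = cong₂ ∧ʳ (dual-involutive χ) (dualC-involutive C)
dualC-involutive (∨ˡ C χ) = cong₂ ∨ˡ (dualC-involutive C) (dual-involutive χ)
dualC-involutive (∨ʳ χ C) = cong₂ ∨ʳ (dual-involutive χ) (dualC-involutive C)
dualC-involutive (⟨⟩ a C) = cong (⟨⟩ a) (dualC-involutive C)
dualC-involutive ([] a C) = cong ([] a) (dualC-involutive C)
dualC-involutive (muC C)  = cong muC (dualC-involutive C)
dualC-involutive (nuC C)  = cong nuC (dualC-involutive C)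

plug-dual : ∀ {k n m} (C : Ctx k n m) ψ → plug (dualC C) (dual ψ) ≡ dual (plug C ψ)
plug-dual hole     ψ = refl
plug-dual (∧ˡ C χ) ψ = cong (_∨ dual χ) (plug-dual C ψ)
plug-dual (∧ʳ χ C) ψ = cong (dual χ ∨_) (plug-dual C ψ)
plug-dual (∨ˡ C χ) ψ = cong (_∧ dual χ) (plug-dual C ψ)
plug-dual (∨ʳ χ C) ψ = cong (dual χ ∧_) (plug-dual C ψ)
plug-dual (⟨⟩ a C) ψ = cong ([ a ]_) (plug-dual C ψ)
plug-dual ([] a C) ψ = cong (⟨ a ⟩_) (plug-dual C ψ)
plug-dual (muC C)  ψ = cong nu (plug-dual C ψ)
plug-dual (nuC C)  ψ = cong mu (plug-dual C ψ)

dualC-⨾ : ∀ {k n m l} (C : Ctx k n m) (D : Ctx k m l) → dualC (C ⨾ D) ≡ dualC C ⨾ dualC D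
dualC-⨾ hole     D = refl
dualC-⨾ (∧ˡ C χ) D = cong (λ E → ∨ˡ E (dual χ)) (dualC-⨾ C D)
dualC-⨾ (∧ʳ χ C) D = cong (∨ʳ (dual χ)) (dualC-⨾ C D)
dualC-⨾ (∨ˡ C χ) D = cong (λ E → ∧ˡ E (dual χ)) (dualC-⨾ C D)
dualC-⨾ (∨ʳ χ C) D = cong (∧ʳ (dual χ)) (dualC-⨾ C D)
dualC-⨾ (⟨⟩ a C) D = cong ([] a) (dualC-⨾ C D)
dualC-⨾ ([] a C) D = cong (⟨⟩ a) (dualC-⨾ C D)
dualC-⨾ (muC C)  D = cong nuC (dualC-⨾ C D)
dualC-⨾ (nuC C)  D = cong muC (dualC-⨾ C D)

liftVar-dualC : ∀ {k n m} (E : Ctx k n m) i → liftVar (dualC E) i ≡ liftVar E i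
liftVar-dualC hole     i = refl
liftVar-dualC (∧ˡ C χ) i = liftVar-dualC C i
liftVar-dualC (∧ʳ χ C) i = liftVar-dualC C i
liftVar-dualC (∨ˡ C χ) i = liftVar-dualC C i
liftVar-dualC (∨ʳ χ C) i = liftVar-dualC C i
liftVar-dualC (⟨⟩ a C) i = liftVar-dualC C i
liftVar-dualC ([] a C) i = liftVar-dualC C i
liftVar-dualC (muC C)  i = liftVar-dualC C (suc i)
liftVar-dualC (nuC C)  i = liftVar-dualC C (suc i)

FreeIn-dual : ∀ {k n} {i : Fin n} {ψ : Form k n} → FreeIn i ψ → FreeIn i (dual ψ)
FreeIn-dual here    = here
FreeIn-dual (∧l f)  = ∨l (FreeIn-dual f)
FreeIn-dual (∧r f)  = ∨r (FreeIn-dual f)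
FreeIn-dual (∨l f)  = ∧l (FreeIn-dual f)
FreeIn-dual (∨r f)  = ∧r (FreeIn-dual f)
FreeIn-dual (dia f) = box (FreeIn-dual f)
FreeIn-dual (box f) = dia (FreeIn-dual f)
FreeIn-dual (mu f)  = nu (FreeIn-dual f)
FreeIn-dual (nu f)  = mu (FreeIn-dual f)

Occurs-tt-dual : ∀ {k n} {ψ : Form k n} → Occurs {k} tt ψ → Occurs {k} ff (dual ψ)
Occurs-tt-dual here    = here
Occurs-tt-dual (∧l o)  = ∨l (Occurs-tt-dual o)
Occurs-tt-dual (∧r o)  = ∨r (Occurs-tt-dual o)
Occurs-tt-dual (∨l o)  = ∧l (Occurs-tt-dual o)
Occurs-tt-dual (∨r o)  = ∧r (Occurs-tt-dual o)
Occurs-tt-dual (dia o) = box (Occurs-tt-dual o)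
Occurs-tt-dual (box o) = dia (Occurs-tt-dual o)
Occurs-tt-dual (mu o)  = nu (Occurs-tt-dual o)
Occurs-tt-dual (nu o)  = mu (Occurs-tt-dual o)

canVerify⇒canRefute-dual : ∀ {k} j {m} (C : Ctx k 0 m) ψ →
                           CanVerifyIn j C ψ → CanRefuteIn j (dualC C) (dual ψ)
canVerify⇒canRefute-dual zero    C ψ o        = Occurs-tt-dual o
canVerify⇒canRefute-dual (suc j) C ψ (inj₁ v) = inj₁ (canVerify⇒canRefute-dual j C ψ v)
canVerify⇒canRefute-dual (suc j) .(D ⨾ muC E) ψ (inj₂ (d , D , E , refl , free , v)) =
  inj₂ (d , dualC D , dualC E , dualC-⨾ D (muC E) ,
        subst (λ i → FreeIn i (dual ψ)) (sym (liftVar-dualC E zero)) (FreeIn-dual free) ,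
        subst (CanRefuteIn j (dualC D)) (cong nu (sym (plug-dual E ψ)))
          (canVerify⇒canRefute-dual j D (mu (plug E ψ)) v))

AllCanVerify⇒AllCanRefute-dual : ∀ {k} (φ : Form k 0) → AllCanVerify φ → AllCanRefute (dual φ)
AllCanVerify⇒AllCanRefute-dual φ hV C ψ C[ψ]≡φ*
  with hV (dualC C) (dual ψ) (trans (plug-dual C ψ) (trans (cong dual C[ψ]≡φ*) (dual-involutive φ)))
... | j , v = j , subst₂ (CanRefuteIn j) (dualC-involutive C) (dual-involutive ψ)
                    (canVerify⇒canRefute-dual j (dualC C) (dual ψ) v)

IsC⇒IsS-dual : ∀ {k n} {φ : Form k n} → IsC φ → IsS (dual φ)
IsC⇒IsS-dual tt        = ff
IsC⇒IsS-dual ff        = tt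
IsC⇒IsS-dual (dia a h) = box a (IsC⇒IsS-dual h)
IsC⇒IsS-dual (or h h′) = and (IsC⇒IsS-dual h) (IsC⇒IsS-dual h′)
IsC⇒IsS-dual (mu h)    = nu (IsC⇒IsS-dual h)
IsC⇒IsS-dual (var i)   = var i

dual-bigOr : ∀ {k n} (l : List (Fin k)) (φs : Fin k → Form k n) →
             dual (bigOr l φs) ≡ bigAnd l (λ a → dual (φs a))
dual-bigOr []          φs = refl
dual-bigOr (a ∷ [])    φs = refl
dual-bigOr (a ∷ b ∷ l) φs = cong (([ a ] dual (φs a)) ∧_) (dual-bigOr (b ∷ l) φs)

dual-bigAnd : ∀ {k n} (l : List (Fin k)) (φs : Fin k → Form k n) →
              dual (bigAnd l φs) ≡ bigOr l (λ a → dual (φs a))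
dual-bigAnd []          φs = refl
dual-bigAnd (a ∷ [])    φs = refl
dual-bigAnd (a ∷ b ∷ l) φs = cong ((⟨ a ⟩ dual (φs a)) ∨_) (dual-bigAnd (b ∷ l) φs)

IsE-dual : ∀ {k n} {φ : Form k n} → IsE φ → IsE (dual φ)
IsE-dual tt         = ff
IsE-dual ff         = tt
IsE-dual (mu h)     = nu (IsE-dual h)
IsE-dual (nu h)     = mu (IsE-dual h)
IsE-dual (var i)    = var i
IsE-dual (or h h′)  = and (IsE-dual h) (IsE-dual h′)
IsE-dual (and h h′) = or (IsE-dual h) (IsE-dual h′)
IsE-dual {k} (bigOrE φs h) =
  subst IsE (sym (dual-bigOr (allFin k) φs)) (bigAndE (λ a → dual (φs a)) (λ a → IsE-dual (h a)))
IsE-dual {k} (bigAndE φs h) =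
  subst IsE (sym (dual-bigAnd (allFin k) φs)) (bigOrE (λ a → dual (φs a)) (λ a → IsE-dual (h a)))

GuardedVar-dual : ∀ {k n} (i : Fin n) (φ : Form k n) → GuardedVar i φ → GuardedVar i (dual φ)
GuardedVar-dual i tt        g        = U.tt
GuardedVar-dual i ff        g        = U.tt
GuardedVar-dual i (φ ∨ ψ)   (g , g′) = GuardedVar-dual i φ g , GuardedVar-dual i ψ g′
GuardedVar-dual i (φ ∧ ψ)   (g , g′) = GuardedVar-dual i φ g , GuardedVar-dual i ψ g′
GuardedVar-dual i (⟨ a ⟩ φ) g        = U.tt
GuardedVar-dual i ([ a ] φ) g        = U.tt
GuardedVar-dual i (mu φ)    g        = GuardedVar-dual (suc i) φ g
GuardedVar-dual i (nu φ)    g        = GuardedVar-dual (suc i) φ g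
GuardedVar-dual i (var j)   g        = g

Guarded-dual : ∀ {k n} (φ : Form k n) → Guarded φ → Guarded (dual φ)
Guarded-dual tt        g        = U.tt
Guarded-dual ff        g        = U.tt
Guarded-dual (φ ∨ ψ)   (g , g′) = Guarded-dual φ g , Guarded-dual ψ g′
Guarded-dual (φ ∧ ψ)   (g , g′) = Guarded-dual φ g , Guarded-dual ψ g′
Guarded-dual (⟨ a ⟩ φ) g        = Guarded-dual φ g
Guarded-dual ([ a ] φ) g        = Guarded-dual φ g
Guarded-dual (mu φ)    (g , g′) = GuardedVar-dual zero φ g , Guarded-dual φ g′
Guarded-dual (nu φ)    (g , g′) = GuardedVar-dual zero φ g , Guarded-dual φ g′
Guarded-dual (var j)   g        = U.tt

swap : Verdict → Verdict
swap end = end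
swap no  = yes
swap yes = no

synthC≡swap-synthS-dual : ∀ {k n} (ψ : Form k n) → synthC ψ ≡ mapV swap (synthS (dual ψ))
synthC≡swap-synthS-dual tt        = refl
synthC≡swap-synthS-dual ff        = refl
synthC≡swap-synthS-dual (φ ∨ ψ)   = cong₂ _⊕_ (synthC≡swap-synthS-dual φ) (synthC≡swap-synthS-dual ψ)
synthC≡swap-synthS-dual (φ ∧ ψ)   = refl
synthC≡swap-synthS-dual (⟨ a ⟩ φ) = cong (a ·_) (synthC≡swap-synthS-dual φ)
synthC≡swap-synthS-dual ([ a ] φ) = refl
synthC≡swap-synthS-dual (mu φ)    = cong rec (synthC≡swap-synthS-dual φ)
synthC≡swap-synthS-dual (nu φ)    = refl
synthC≡swap-synthS-dual (var i)   = refl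

synthC-persistent : ∀ {k} (φ : Form k 0) → IsC φ → Guarded φ → IsE φ → AllCanVerify φ →
  ∀ s → Σ (List (Fin k)) λ w → ShowsAfter yes (sub ∅ₛ (synthC φ)) (s ++ w)
synthC-persistent φ hC hG hE hV s
  with synthS-persistent (dual φ) (IsC⇒IsS-dual hC) (Guarded-dual φ hG) (IsE-dual hE)
         (AllCanVerify⇒AllCanRefute-dual φ hV) s
... | w , p = w , subst (λ M → ShowsAfter yes M (s ++ w)) swapped (mapV-ShowsAfter swap p)
  where
  swapped : mapV swap (sub ∅ₛ (synthS (dual φ))) ≡ sub ∅ₛ (synthC φ)
  swapped = begin
    mapV swap (sub ∅ₛ (synthS (dual φ)))          ≡⟨ mapV-sub swap ∅ₛ (synthS (dual φ)) ⟩
    sub _ (mapV swap (synthS (dual φ)))           ≡⟨ sub-cong (λ ()) (mapV swap (synthS (dual φ))) ⟩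
    sub ∅ₛ (mapV swap (synthS (dual φ)))          ≡⟨ cong (sub ∅ₛ) (sym (synthC≡swap-synthS-dual φ)) ⟩
    sub ∅ₛ (synthC φ)                             ∎
    where open ≡-Reasoning

synthS-sound₀ : ∀ {k} (φ : Form k 0) → IsS φ → Guarded φ →
  ∀ s t → Prefix s t → ShowsAfter no (sub ∅ₛ (synthS φ)) s → ¬ ⟦ φ ⟧₀ t
synthS-sound₀ φ hS hG s t pre p sat = synthS-sound (length s) φ hS hG ∅ₛ _ s ≤-refl (λ ()) (λ ()) t pre sat p

synthC-sound₀ : ∀ {k} (φ : Form k 0) → IsC φ → Guarded φ →
  ∀ s t → Prefix s t → ShowsAfter yes (sub ∅ₛ (synthC φ)) s → ⟦ φ ⟧₀ t
synthC-sound₀ φ hC hG s t pre p = synthC-sound (length s) φ hC hG ∅ₛ _ s ≤-refl (λ ()) (λ ()) t pre p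

persistentMonitor : ∀ {k ℓ} (v : Verdict) (M : Mon k 0) (Q : Trace k → Set ℓ) →
  (∀ s t → Prefix s t → ShowsAfter v M s → Q t) →
  (∀ s → Σ (List (Fin k)) λ w → ShowsAfter v M (s ++ w)) →
  Σ (Mon k 0) λ m → (∀ f → reaches v m f → Q f) ×
                    (∀ s → Σ (Trace k) λ f → reaches v m (s ++ᵗ f)) ×
                    (∀ {u} → ¬ v ≡ u → Avoids u M → Avoids u m)
-- Without actions the only trace is ε, on which M moves nowhere; `verd v` already reaches v.
persistentMonitor {zero} v M Q sound persistent =
  verd v , reaches⇒Q , (λ s → fin [] , verd-⇒-verd (s ++ [])) , λ v≢u _ → verd v≢u
  where
  reaches⇒Q : ∀ f → reaches v (verd v) f → Q f
  reaches⇒Q (fin (() ∷ _)) _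
  reaches⇒Q (inf g)        _ with g zero
  ... | ()
  reaches⇒Q (fin [])       _ with persistent []
  ... | [] , p = sound [] (fin []) U.tt p
  ... | () ∷ _ , _
persistentMonitor {suc k} v M Q sound persistent = M , reaches⇒Q , extension , λ _ avoids → avoids
  where
  reaches⇒Q : ∀ f → reaches v M f → Q f
  reaches⇒Q (fin s) p       = sound s (fin s) (fin-Prefix s) (⇒-ShowsAfter p)
  reaches⇒Q (inf g) (n , p) = sound (takeω n g) (inf g) (takeω-Prefix n g) (⇒-ShowsAfter p)
  extension : ∀ s → Σ (Trace (suc k)) λ f → reaches v M (s ++ᵗ f)
  extension s with persistent s
  ... | w , _ , p , x = fin (w ++ zero ∷ []) ,
    subst (λ l → M =[ l ]⇒ verd v) (++-assoc s w (zero ∷ [])) (⇒-snoc p (Shows⇒step x))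

lemma15 : (k : ℕ) →
    ((φ : Form k 0) → SPIHML φ →
      Σ (Mon k 0) λ m → Sound m ⟦ φ ⟧₀ × ViolationPersistentlyInformative m)
    ×
    ((φ : Form k 0) → CPIHML φ →
      Σ (Mon k 0) λ m → Sound m ⟦ φ ⟧₀ × SatisfactionPersistentlyInformative m)
lemma15 k = violation , satisfaction
  where
  violation : (φ : Form k 0) → SPIHML φ →
              Σ (Mon k 0) λ m → Sound m ⟦ φ ⟧₀ × ViolationPersistentlyInformative m
  violation .(φ₁ ∧ φ₂) (spi φ₁ φ₂ (g₁ , _) hS hE hR)
    with persistentMonitor no (sub ∅ₛ (synthS φ₁)) (λ t → ¬ ⟦ φ₁ ⟧₀ t)
           (synthS-sound₀ φ₁ hS g₁) (synthS-persistent φ₁ hS g₁ hE hR)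
  ... | m , rej⇒¬φ₁ , informative , avoids =
    m , ((λ f a → ⊥-elim (Avoids⇒¬reaches never-accepts f a)) , λ f r sat → rej⇒¬φ₁ f r (proj₁ sat)) ,
    informative
    where
    never-accepts : Avoids yes m
    never-accepts = avoids (λ ()) (Avoids-sub (λ ()) (synthS-avoids-yes φ₁))
  satisfaction : (φ : Form k 0) → CPIHML φ →
                 Σ (Mon k 0) λ m → Sound m ⟦ φ ⟧₀ × SatisfactionPersistentlyInformative m
  satisfaction .(φ₁ ∨ φ₂) (cpi φ₁ φ₂ (g₁ , _) hC hE hV)
    with persistentMonitor yes (sub ∅ₛ (synthC φ₁)) ⟦ φ₁ ⟧₀
           (synthC-sound₀ φ₁ hC g₁) (synthC-persistent φ₁ hC g₁ hE hV)
  ... | m , acc⇒φ₁ , informative , avoids =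
    m , ((λ f a → inj₁ (acc⇒φ₁ f a)) , λ f r → ⊥-elim (Avoids⇒¬reaches never-rejects f r)) ,
    informative
    where
    never-rejects : Avoids no m
    never-rejects = avoids (λ ()) (Avoids-sub (λ ()) (synthC-avoids-no φ₁))
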